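{- Let $R$ be a unique factorization domain with field of fractions $k$, and let $T(x,y)=\sum_{i,j}t_{i,j}x^iy^j\in R[x,y]$ be an $(n,r)$-Brylawski polynomial, where $n,r$ are integers with $r\geq 1$ and $n-r\geq 1$. Suppose that (i) neither $x-1$ nor $y-1$ divides $T(x,y)$; (ii) $t_{1,0}\neq 0$; and (iii) $\deg_x T+\deg_y T\in\{n,n+1\}$. If $T(x,y)=U(x,y)V(x,y)$ with $U,V\in R[x,y]$, then $U(x,y)$ or $V(x,y)$ is a constant (an element of $R$). In particular $T(x,y)$ is irreducible in $k[x,y]$; moreover, if $\gcd_{i,j}\{t_{i,j}\}=1$, then $T(x,y)$ is irreducible in $R[x,y]$.
   Context: For a commutative ring $R$, a polynomial $U(x,y)\in R[x,y]$ is called an $(n,r)$-Brylawski polynomial (with constant $c$) if $(y-1)^rU\big(\frac{y}{y-1},y\big)=cy^n$ for some non-negative integer $n$, some integer $r$ (possibly negative or larger than $n$), and some non-zero constant $c\in R$; equivalently $(x-1)^{n-r}U\big(x,\frac{x}{x-1}\big)=cx^n$. For $U=\sum u_{i,j}x^iy^j$, $\deg_x U=\max\{i:\exists j,\ u_{i,j}\neq 0\}$ and $\deg_y U=\max\{j:\exists i,\ u_{i,j}\neq 0\}$. -}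

module Defs where

open import Level using (Level; _⊔_)
open import Data.Nat as ℕ using (ℕ; zero; suc; _∸_; _<_; _≤_)
open import Data.Fin using (Fin)
import Data.Fin as Fin
open import Data.Product using (Σ; _×_; _,_)
open import Data.Sum using (_⊎_)
import Data.Sum
open import Relation.Nullary using (¬_; yes; no)
open import Relation.Binary.PropositionalEquality using (_≡_)
open import Function.Bundles using (_↔_; Inverse)
open import Algebra.Bundles using (CommutativeRing)
open import Algebra.Morphism.Structures using (module RingMorphisms)

-- Polynomials are represented by their coefficient functions
-- (coefficient of x^i y^j, resp. y^i), equality is coefficientwise
-- with respect to the ring's setoid equality.

module Over {c ℓ : Level} (R : CommutativeRing c ℓ) where

  open CommutativeRing R

  sumR : ℕ → (ℕ → Carrier) → Carrier
  sumR zero    f = 0#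
  sumR (suc n) f = sumR n f + f n

  prodF : (m : ℕ) → (Fin m → Carrier) → Carrier
  prodF zero    p = 1#
  prodF (suc m) p = p Fin.zero * prodF m (λ i → p (Fin.suc i))

  _∣R_ : Carrier → Carrier → Set (c ⊔ ℓ)
  a ∣R b = Σ Carrier λ q → b ≈ a * q

  Unit : Carrier → Set (c ⊔ ℓ)
  Unit a = Σ Carrier λ b → a * b ≈ 1#

  IrreducibleElt : Carrier → Set (c ⊔ ℓ)
  IrreducibleElt a = (a ≉ 0#) × (¬ Unit a)
                   × (∀ b d → a ≈ b * d → Unit b ⊎ Unit d)

  Associated : Carrier → Carrier → Set (c ⊔ ℓ)
  Associated a b = Σ Carrier λ u → Unit u × (a ≈ u * b)

  IsIntegralDomain : Set (c ⊔ ℓ)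
  IsIntegralDomain = (1# ≉ 0#) × (∀ a b → a * b ≈ 0# → a ≈ 0# ⊎ b ≈ 0#)

  Factorization : Carrier → Set (c ⊔ ℓ)
  Factorization a =
    Σ ℕ λ m → Σ (Fin m → Carrier) λ p →
      (∀ i → IrreducibleElt (p i)) ×
      (Σ Carrier λ u → Unit u × (a ≈ u * prodF m p))

  IsUFD : Set (c ⊔ ℓ)
  IsUFD =
    IsIntegralDomain ×
    (∀ a → a ≉ 0# → ¬ Unit a → Factorization a) ×
    (∀ m (p : Fin m → Carrier) m' (q : Fin m' → Carrier) →
       (∀ i → IrreducibleElt (p i)) → (∀ i → IrreducibleElt (q i)) →
       Associated (prodF m p) (prodF m' q) →
       Σ (Fin m ↔ Fin m') λ σ → ∀ i → Associated (p i) (q (Inverse.to σ i)))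

  Coeffs1 : Set c
  Coeffs1 = ℕ → Carrier

  _*₁_ : Coeffs1 → Coeffs1 → Coeffs1
  (f *₁ g) k = sumR (suc k) (λ a → f a * g (k ∸ a))

  ym1 : Coeffs1
  ym1 zero          = - 1#
  ym1 (suc zero)    = 1#
  ym1 (suc (suc _)) = 0#

  one₁ : Coeffs1
  one₁ zero    = 1#
  one₁ (suc _) = 0#

  _^₁_ : Coeffs1 → ℕ → Coeffs1
  f ^₁ zero  = one₁
  f ^₁ suc k = f *₁ (f ^₁ k)

  monoY : ℕ → Coeffs1
  monoY m i with i ℕ.≟ m
  ... | yes _ = 1#
  ... | no  _ = 0#

  scale₁ : Carrier → Coeffs1 → Coeffs1
  scale₁ a f i = a * f i

  Coeffs2 : Set c
  Coeffs2 = ℕ → ℕ → Carrier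

  BoundedBy : ℕ → Coeffs2 → Set ℓ
  BoundedBy B u = ∀ i j → B < i ⊎ B < j → u i j ≈ 0#

  record Poly2 : Set (c ⊔ ℓ) where
    field
      coeff   : Coeffs2
      bound   : ℕ
      bounded : BoundedBy bound coeff
  open Poly2 public

  _≋_ : Poly2 → Poly2 → Set ℓ
  P ≋ Q = ∀ i j → coeff P i j ≈ coeff Q i j

  mulCoeff : Poly2 → Poly2 → Coeffs2
  mulCoeff P Q i j =
    sumR (suc i) λ a → sumR (suc j) λ b →
      coeff P a b * coeff Q (i ∸ a) (j ∸ b)

  IsProduct : Poly2 → Poly2 → Poly2 → Set ℓ
  IsProduct T P Q = ∀ i j → coeff T i j ≈ mulCoeff P Q i j

  Divides2 : Poly2 → Poly2 → Set (c ⊔ ℓ)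
  Divides2 P T = Σ Poly2 λ Q → IsProduct T P Q

  xm1 : Poly2
  xm1 = record { coeff = cf ; bound = 1 ; bounded = bd }
    where
      cf : Coeffs2
      cf zero          zero    = - 1#
      cf (suc zero)    zero    = 1#
      cf _             _       = 0#
      bd : BoundedBy 1 cf
      bd (suc (suc i)) j       _ = refl
      bd zero          (suc j) _ = refl
      bd (suc zero)    (suc j) _ = refl
      bd zero          zero    (Data.Sum.inj₁ ())
      bd zero          zero    (Data.Sum.inj₂ ())
      bd (suc zero)    zero    (Data.Sum.inj₁ (ℕ.s≤s ()))
      bd (suc zero)    zero    (Data.Sum.inj₂ ())

  ym1₂ : Poly2
  ym1₂ = record { coeff = cf ; bound = 1 ; bounded = bd }
    where
      cf : Coeffs2
      cf zero zero       = - 1#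
      cf zero (suc zero) = 1#
      cf _    _          = 0#
      bd : BoundedBy 1 cf
      bd zero    (suc (suc j)) _ = refl
      bd (suc i) j             _ = refl
      bd zero    zero    (Data.Sum.inj₁ ())
      bd zero    zero    (Data.Sum.inj₂ ())
      bd zero    (suc zero) (Data.Sum.inj₁ ())
      bd zero    (suc zero) (Data.Sum.inj₂ (ℕ.s≤s ()))

  one₂ : Poly2
  one₂ = record { coeff = cf ; bound = 0 ; bounded = bd }
    where
      cf : Coeffs2
      cf zero zero = 1#
      cf _    _    = 0#
      bd : BoundedBy 0 cf
      bd zero    (suc j) _ = refl
      bd (suc i) j       _ = refl
      bd zero    zero    (Data.Sum.inj₁ ())
      bd zero    zero    (Data.Sum.inj₂ ())

  IsConstant : Poly2 → Set ℓ
  IsConstant U = ∀ i j → 1 ≤ i ℕ.+ j → coeff U i j ≈ 0#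

  DegX : Poly2 → ℕ → Set ℓ
  DegX P d = (Σ ℕ λ j → coeff P d j ≉ 0#) × (∀ i j → d < i → coeff P i j ≈ 0#)

  DegY : Poly2 → ℕ → Set ℓ
  DegY P d = (Σ ℕ λ i → coeff P i d ≉ 0#) × (∀ i j → d < j → coeff P i j ≈ 0#)

  Unit2 : Poly2 → Set (c ⊔ ℓ)
  Unit2 U = Σ Poly2 λ W → IsProduct one₂ U W

  Irreducible2 : Poly2 → Set (c ⊔ ℓ)
  Irreducible2 T =
    (¬ (∀ i j → coeff T i j ≈ 0#)) × (¬ Unit2 T) ×
    (∀ U V → IsProduct T U V → Unit2 U ⊎ Unit2 V)

  ContentOne : Poly2 → Set (c ⊔ ℓ)
  ContentOne T = ∀ g → (∀ i j → g ∣R coeff T i j) → Unit g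

  -- For U with coefficients vanishing outside [0,B]², in k(y)
  --   (y-1)^B · U(y/(y-1), y) = Σ_{i,j ≤ B} u_{i,j} y^{i+j} (y-1)^{B-i} =: P_B(y),
  -- so (y-1)^r U(y/(y-1),y) = c y^n  (r ≥ 0) is, after multiplying by (y-1)^B,
  -- the polynomial identity  (y-1)^r · P_B(y) = c · y^n · (y-1)^B  in R[y].

  brylawskiClear : Coeffs2 → ℕ → Coeffs1
  brylawskiClear u B m =
    sumR (suc B) λ i → sumR (suc B) λ j →
      u i j * (monoY (i ℕ.+ j) *₁ (ym1 ^₁ (B ∸ i))) m

  IsBrylawski : ℕ → ℕ → Carrier → Poly2 → Set ℓ
  IsBrylawski n r cst U =
    (cst ≉ 0#) ×
    (∀ m → ((ym1 ^₁ r) *₁ brylawskiClear (coeff U) (bound U)) m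
             ≈ scale₁ cst (monoY n *₁ (ym1 ^₁ bound U)) m)

record FractionField {c ℓ c' ℓ' : Level} (R : CommutativeRing c ℓ)
                     (K : CommutativeRing c' ℓ') : Set (c ⊔ ℓ ⊔ c' ⊔ ℓ') where
  private
    module R = CommutativeRing R
    module K = CommutativeRing K
  open RingMorphisms R.rawRing K.rawRing
  field
    ι         : R.Carrier → K.Carrier
    ι-hom     : IsRingHomomorphism ι
    ι-inj     : ∀ a b → ι a K.≈ ι b → a R.≈ b
    K-nontriv : K.1# K.≉ K.0#
    K-inv     : ∀ z → z K.≉ K.0# → Σ K.Carrier λ w → z K.* w K.≈ K.1#
    K-frac    : ∀ z → Σ R.Carrier λ a → Σ R.Carrier λ b →
                  (b R.≉ R.0#) × (z K.* ι b K.≈ ι a)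

module Submission where

-- Write Q_α(P) = (y-1)^α P(y/(y-1), y). It is multiplicative, and the Brylawski identity says
-- Q(T) = c·yⁿ·(y-1)^m. Since n ≥ 1, t₀₀ = u₀₀v₀₀ = 0; say u₀₀ = 0, so v₀₀ ≠ 0 because t₁₀ ≠ 0.
-- Then Q(V) divides c·yⁿ·(y-1)^m and does not vanish at 0, so Q(V) = e·(y-1)^k with k ≤ m, and
-- comparing degrees against deg_x T + deg_y T ≤ n + 1 leaves deg_x V + deg_y V ≤ 1. For
-- V = v₀₀ + v₁₀x or v₀₀ + v₀₁y the two possible shapes of Q(V) make V either constant or divisible
-- by x - 1, resp. y - 1, which T is not. Over the fraction field, or when the content of T is 1,
-- the constant factors are units.

open import Defs
open import Level using (Level; _⊔_)
open import Data.Nat as ℕ using (ℕ; zero; suc; _∸_; _≤_; _<_; z≤n; s≤s)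
import Data.Nat.Properties as ℕP
open import Data.Product using (Σ; _×_; _,_; proj₁; proj₂)
open import Data.Sum using (_⊎_; inj₁; inj₂; swap; [_,_])
open import Relation.Nullary using (¬_; yes; no; contradiction)
open import Relation.Binary.PropositionalEquality as Eq using (_≡_; _≢_)
open import Relation.Binary.Definitions using (tri<; tri≈; tri>)
import Relation.Binary.Reasoning.Setoid
open import Algebra.Bundles using (CommutativeRing)
open import Algebra.Structures using (IsCommutativeRing)
open import Function using (_∘_)

+-∸-interchange : ∀ {m n o p} → o ≤ m → p ≤ n → (m ℕ.+ n) ∸ (o ℕ.+ p) ≡ (m ∸ o) ℕ.+ (n ∸ p)
+-∸-interchange {m} {n} {o} {p} o≤m p≤n = begin
  (m ℕ.+ n) ∸ (o ℕ.+ p) ≡⟨ Eq.sym (ℕP.∸-+-assoc (m ℕ.+ n) o p) ⟩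
  (m ℕ.+ n) ∸ o ∸ p     ≡⟨ Eq.cong (_∸ p) (ℕP.+-∸-comm n o≤m) ⟩
  ((m ∸ o) ℕ.+ n) ∸ p   ≡⟨ ℕP.+-∸-assoc (m ∸ o) p≤n ⟩
  (m ∸ o) ℕ.+ (n ∸ p)   ∎
  where open Eq.≡-Reasoning

m≤n∧n+o<p⇒o<p∸m : ∀ {m n o p} → m ≤ n → n ℕ.+ o < p → o < p ∸ m
m≤n∧n+o<p⇒o<p∸m {m} {n} {o} m≤n n+o<p =
  ℕP.m+n≤o⇒m≤o∸n (suc o) (ℕP.≤-trans (s≤s (ℕP.≤-trans (ℕP.+-monoʳ-≤ o m≤n) (ℕP.≤-reflexive (ℕP.+-comm o n)))) n+o<p)

n+m≤s+k⇒t≤1 : ∀ {n m k s t} → k ≤ m → s ℕ.+ t ≤ suc n → n ℕ.+ m ≤ s ℕ.+ k → t ≤ 1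
n+m≤s+k⇒t≤1 {n} {m} {k} {s} {t} k≤m s+t≤1+n n+m≤s+k = ℕP.+-cancelˡ-≤ s t 1 (begin
  s ℕ.+ t   ≤⟨ s+t≤1+n ⟩
  suc n     ≤⟨ s≤s n≤s ⟩
  suc s     ≡⟨ ℕP.+-comm 1 s ⟩
  s ℕ.+ 1   ∎)
  where
    open ℕP.≤-Reasoning
    n≤s : n ≤ s
    n≤s = ℕP.+-cancelʳ-≤ m n s (ℕP.≤-trans n+m≤s+k (ℕP.+-monoʳ-≤ s k≤m))

module Sums {a ℓa : Level} (A : CommutativeRing a ℓa) where
  open CommutativeRing A hiding (zero)
  open Over A using (sumR)
  open import Relation.Binary.Reasoning.Setoid setoid

  sum-cong-< : ∀ n {f g : ℕ → Carrier} → (∀ i → i < n → f i ≈ g i) → sumR n f ≈ sumR n g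
  sum-cong-< zero    f≈g = refl
  sum-cong-< (suc n) f≈g = +-cong (sum-cong-< n (λ i i<n → f≈g i (ℕP.m<n⇒m<1+n i<n))) (f≈g n ℕP.≤-refl)

  sum-cong : ∀ n {f g : ℕ → Carrier} → (∀ i → f i ≈ g i) → sumR n f ≈ sumR n g
  sum-cong n f≈g = sum-cong-< n (λ i _ → f≈g i)

  sum-zero : ∀ n {f : ℕ → Carrier} → (∀ i → i < n → f i ≈ 0#) → sumR n f ≈ 0#
  sum-zero zero    f≈0 = refl
  sum-zero (suc n) f≈0 =
    trans (+-cong (sum-zero n (λ i i<n → f≈0 i (ℕP.m<n⇒m<1+n i<n))) (f≈0 n ℕP.≤-refl)) (+-identityˡ 0#)

  sum-+ : ∀ n (f g : ℕ → Carrier) → sumR n (λ i → f i + g i) ≈ sumR n f + sumR n g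
  sum-+ zero    f g = sym (+-identityˡ 0#)
  sum-+ (suc n) f g = begin
    sumR n (λ i → f i + g i) + (f n + g n) ≈⟨ +-congʳ (sum-+ n f g) ⟩
    (sumR n f + sumR n g) + (f n + g n)    ≈⟨ +-interchange _ _ _ _ ⟩
    (sumR n f + f n) + (sumR n g + g n)    ∎
    where open import Algebra.Properties.CommutativeSemigroup +-commutativeSemigroup
            renaming (interchange to +-interchange)

  *-distribˡ-sum : ∀ n x (f : ℕ → Carrier) → x * sumR n f ≈ sumR n (λ i → x * f i)
  *-distribˡ-sum zero    x f = zeroʳ x
  *-distribˡ-sum (suc n) x f = trans (distribˡ x _ _) (+-congʳ (*-distribˡ-sum n x f))

  *-distribʳ-sum : ∀ n x (f : ℕ → Carrier) → sumR n f * x ≈ sumR n (λ i → f i * x)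
  *-distribʳ-sum n x f = trans (*-comm _ _) (trans (*-distribˡ-sum n x f) (sum-cong n (λ i → *-comm _ _)))

  sum-unfoldˡ : ∀ n (f : ℕ → Carrier) → sumR (suc n) f ≈ f 0 + sumR n (f ∘ suc)
  sum-unfoldˡ zero    f = trans (+-identityˡ _) (sym (+-identityʳ _))
  sum-unfoldˡ (suc n) f = trans (+-congʳ (sum-unfoldˡ n f)) (+-assoc _ _ _)

  sum-reverse : ∀ n (f : ℕ → Carrier) → sumR n f ≈ sumR n (λ i → f (n ∸ suc i))
  sum-reverse zero    f = refl
  sum-reverse (suc n) f = sym (begin
    sumR (suc n) (λ i → f (suc n ∸ suc i)) ≈⟨ sum-unfoldˡ n (λ i → f (suc n ∸ suc i)) ⟩
    f n + sumR n (λ i → f (n ∸ suc i))     ≈⟨ +-congˡ (sym (sum-reverse n f)) ⟩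
    f n + sumR n f                         ≈⟨ +-comm _ _ ⟩
    sumR n f + f n                         ∎)

  sum-truncate : ∀ k m (f : ℕ → Carrier) → k ≤ m → (∀ i → k ≤ i → f i ≈ 0#) → sumR m f ≈ sumR k f
  sum-truncate k zero    f z≤n _   = refl
  sum-truncate k (suc m) f k≤1+m f≈0 with ℕP.m≤n⇒m<n∨m≡n k≤1+m
  ... | inj₁ k≤m   = trans (+-cong (sum-truncate k m f (ℕP.≤-pred k≤m) f≈0) (f≈0 m (ℕP.≤-pred k≤m))) (+-identityʳ _)
  ... | inj₂ Eq.refl = refl

  sum-single : ∀ n p (f : ℕ → Carrier) → p < n → (∀ i → i < n → i ≢ p → f i ≈ 0#) → sumR n f ≈ f p
  sum-single (suc n) p f p<1+n f≈0 with p ℕ.≟ n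
  ... | yes Eq.refl =
    trans (+-congʳ (sum-zero n (λ i i<n → f≈0 i (ℕP.m<n⇒m<1+n i<n) (ℕP.<⇒≢ i<n)))) (+-identityˡ _)
  ... | no p≢n =
    trans (+-cong (sum-single n p f (ℕP.≤∧≢⇒< (ℕP.≤-pred p<1+n) p≢n) (λ i i<n → f≈0 i (ℕP.m<n⇒m<1+n i<n)))
                  (f≈0 n ℕP.≤-refl (p≢n ∘ Eq.sym)))
          (+-identityʳ _)

  sum-swap : ∀ m n (h : ℕ → ℕ → Carrier) →
             sumR m (λ i → sumR n (h i)) ≈ sumR n (λ j → sumR m (λ i → h i j))
  sum-swap zero    n h = sym (sum-zero n (λ _ _ → refl))
  sum-swap (suc m) n h = trans (+-congʳ (sum-swap m n h)) (sym (sum-+ n _ _))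

  sum-antidiagonal : ∀ n (h : ℕ → ℕ → Carrier) →
    sumR n (λ k → sumR (suc k) (λ i → h i (k ∸ i))) ≈ sumR n (λ i → sumR (n ∸ i) (h i))
  sum-antidiagonal zero    h = refl
  sum-antidiagonal (suc n) h = begin
    sumR n (λ k → sumR (suc k) (λ i → h i (k ∸ i))) + sumR (suc n) (λ i → h i (n ∸ i))
      ≈⟨ +-congʳ (sum-antidiagonal n h) ⟩
    sumR n (λ i → sumR (n ∸ i) (h i)) + sumR (suc n) (λ i → h i (n ∸ i))
      ≈⟨ +-congʳ (sym (trans (+-congˡ empty) (+-identityʳ _))) ⟩
    sumR (suc n) (λ i → sumR (n ∸ i) (h i)) + sumR (suc n) (λ i → h i (n ∸ i))
      ≈⟨ sym (sum-+ (suc n) _ _) ⟩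
    sumR (suc n) (λ i → sumR (n ∸ i) (h i) + h i (n ∸ i))
      ≈⟨ sum-cong-< (suc n) (λ i i<1+n → reflexive (Eq.cong (λ k → sumR k (h i))
                                          (Eq.sym (ℕP.+-∸-assoc 1 (ℕP.≤-pred i<1+n))))) ⟩
    sumR (suc n) (λ i → sumR (suc n ∸ i) (h i)) ∎
    where
      empty : sumR (n ∸ n) (h n) ≈ 0#
      empty rewrite ℕP.n∸n≡0 n = refl

  sum-cauchy : ∀ α β N (h : ℕ → ℕ → Carrier) →
    (∀ i j → α < i → h i j ≈ 0#) → (∀ i j → β < j → h i j ≈ 0#) → α ℕ.+ β < N →
    sumR N (λ k → sumR (suc k) (λ i → h i (k ∸ i))) ≈ sumR (suc α) (λ i → sumR (suc β) (h i))
  sum-cauchy α β N h hα hβ α+β<N = begin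
    sumR N (λ k → sumR (suc k) (λ i → h i (k ∸ i))) ≈⟨ sum-antidiagonal N h ⟩
    sumR N (λ i → sumR (N ∸ i) (h i))
      ≈⟨ sum-truncate (suc α) N _ (ℕP.≤-trans (s≤s (ℕP.m≤m+n α β)) α+β<N)
                      (λ i α<i → sum-zero (N ∸ i) (λ j _ → hα i j α<i)) ⟩
    sumR (suc α) (λ i → sumR (N ∸ i) (h i))
      ≈⟨ sum-cong-< (suc α) (λ i i<1+α →
           sum-truncate (suc β) (N ∸ i) (h i) (m≤n∧n+o<p⇒o<p∸m (ℕP.≤-pred i<1+α) α+β<N) (λ j β<j → hβ i j β<j)) ⟩
    sumR (suc α) (λ i → sumR (suc β) (h i)) ∎

module Convolution {a ℓa : Level} (A : CommutativeRing a ℓa) where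
  open CommutativeRing A hiding (zero)
  open Over A
  open Sums A
  open import Relation.Binary.Reasoning.Setoid setoid

  infix  4 _≈₁_
  infixl 6 _+₁_
  infix  8 -₁_

  _≈₁_ : Coeffs1 → Coeffs1 → Set ℓa
  f ≈₁ g = ∀ i → f i ≈ g i

  _+₁_ : Coeffs1 → Coeffs1 → Coeffs1
  (f +₁ g) i = f i + g i

  -₁_ : Coeffs1 → Coeffs1
  (-₁ f) i = - f i

  0₁ : Coeffs1
  0₁ _ = 0#

  *₁-cong : ∀ {f f' g g'} → f ≈₁ f' → g ≈₁ g' → f *₁ g ≈₁ f' *₁ g'
  *₁-cong f≈f' g≈g' k = sum-cong (suc k) (λ i → *-cong (f≈f' i) (g≈g' (k ∸ i)))

  *₁-comm : ∀ f g → f *₁ g ≈₁ g *₁ f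
  *₁-comm f g k = begin
    sumR (suc k) (λ i → f i * g (k ∸ i))             ≈⟨ sum-reverse (suc k) _ ⟩
    sumR (suc k) (λ i → f (k ∸ i) * g (k ∸ (k ∸ i))) ≈⟨ sum-cong-< (suc k) (λ i i<1+k →
      trans (*-comm _ _) (*-congʳ (reflexive (Eq.cong g (ℕP.m∸[m∸n]≡n (ℕP.≤-pred i<1+k)))))) ⟩
    sumR (suc k) (λ i → g i * f (k ∸ i))             ∎

  *₁-distribˡ-+₁ : ∀ f g h → f *₁ (g +₁ h) ≈₁ f *₁ g +₁ f *₁ h
  *₁-distribˡ-+₁ f g h k = trans (sum-cong (suc k) (λ i → distribˡ _ _ _)) (sum-+ (suc k) _ _)

  *₁-identityˡ : ∀ f → one₁ *₁ f ≈₁ f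
  *₁-identityˡ f k = trans (sum-single (suc k) 0 _ (s≤s z≤n) one₁-off) (*-identityˡ _)
    where
      one₁-off : ∀ i → i < suc k → i ≢ 0 → one₁ i * f (k ∸ i) ≈ 0#
      one₁-off zero    _ 0≢0 = contradiction Eq.refl 0≢0
      one₁-off (suc i) _ _   = zeroˡ _

  *₁-assoc : ∀ f g h → (f *₁ g) *₁ h ≈₁ f *₁ (g *₁ h)
  *₁-assoc f g h k = begin
    sumR (suc k) (λ i → sumR (suc i) (λ j → f j * g (i ∸ j)) * h (k ∸ i))
      ≈⟨ sum-cong-< (suc k) (λ i _ → trans (*-distribʳ-sum (suc i) _ _) (sum-cong-< (suc i) (λ j j<1+i →
           *-congˡ (reflexive (Eq.cong (λ z → h (k ∸ z)) (Eq.sym (ℕP.m+[n∸m]≡n (ℕP.≤-pred j<1+i)))))))) ⟩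
    sumR (suc k) (λ i → sumR (suc i) (λ j → H j (i ∸ j)))  ≈⟨ sum-antidiagonal (suc k) H ⟩
    sumR (suc k) (λ j → sumR (suc k ∸ j) (H j))
      ≈⟨ sum-cong-< (suc k) (λ j j<1+k → trans
           (reflexive (Eq.cong (λ z → sumR z (H j)) (ℕP.+-∸-assoc 1 (ℕP.≤-pred j<1+k))))
           (trans (sum-cong (suc (k ∸ j)) (λ b → trans (*-assoc _ _ _)
                     (*-congˡ (*-congˡ (reflexive (Eq.cong h (Eq.sym (ℕP.∸-+-assoc k j b))))))))
                  (sym (*-distribˡ-sum (suc (k ∸ j)) _ _)))) ⟩
    sumR (suc k) (λ j → f j * sumR (suc (k ∸ j)) (λ b → g b * h (k ∸ j ∸ b))) ∎
    where
      H : ℕ → ℕ → Carrier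
      H j b = f j * g b * h (k ∸ (j ℕ.+ b))

  A[y]-isCommutativeRing : IsCommutativeRing _≈₁_ _+₁_ _*₁_ -₁_ 0₁ one₁
  A[y]-isCommutativeRing = record
    { isRing = record
      { +-isAbelianGroup = record
        { isGroup = record
          { isMonoid = record
            { isSemigroup = record
              { isMagma = record
                { isEquivalence = record
                  { refl = λ _ → refl ; sym = λ p i → sym (p i) ; trans = λ p q i → trans (p i) (q i) }
                ; ∙-cong = λ p q i → +-cong (p i) (q i) }
              ; assoc = λ _ _ _ _ → +-assoc _ _ _ }
            ; identity = (λ _ _ → +-identityˡ _) , (λ _ _ → +-identityʳ _) }
          ; inverse = (λ _ _ → -‿inverseˡ _) , (λ _ _ → -‿inverseʳ _)
          ; ⁻¹-cong = λ p i → -‿cong (p i) }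
        ; comm = λ _ _ _ → +-comm _ _ }
      ; *-cong = *₁-cong
      ; *-assoc = *₁-assoc
      ; *-identity = *₁-identityˡ , (λ f k → trans (*₁-comm f one₁ k) (*₁-identityˡ f k))
      ; distrib = *₁-distribˡ-+₁ , (λ f g h k → trans (*₁-comm (g +₁ h) f k)
                    (trans (*₁-distribˡ-+₁ f g h k) (+-cong (*₁-comm f g k) (*₁-comm f h k)))) }
    ; *-comm = *₁-comm }

  A[y] : CommutativeRing a ℓa
  A[y] = record { isCommutativeRing = A[y]-isCommutativeRing }

  module Poly = CommutativeRing A[y]

  *₁-congˡ : ∀ f {g h} → g ≈₁ h → f *₁ g ≈₁ f *₁ h
  *₁-congˡ f g≈h = *₁-cong {f} {f} (λ _ → refl) g≈h

  *₁-congʳ : ∀ f {g h} → g ≈₁ h → g *₁ f ≈₁ h *₁ f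
  *₁-congʳ f g≈h = *₁-cong {g' = f} g≈h (λ _ → refl)

  *₁-zeroˡ : ∀ f g → f ≈₁ 0₁ → f *₁ g ≈₁ 0₁
  *₁-zeroˡ f g f≈0 = Poly.trans (*₁-congʳ g f≈0) (Poly.zeroˡ g)

  *₁-zeroʳ : ∀ f g → g ≈₁ 0₁ → f *₁ g ≈₁ 0₁
  *₁-zeroʳ f g g≈0 = Poly.trans (*₁-congˡ f g≈0) (Poly.zeroʳ f)

module Univariate {a ℓa : Level} (A : CommutativeRing a ℓa) where
  open CommutativeRing A hiding (zero)
  open Over A
  open Sums A
  open Convolution A
  open import Algebra.Properties.Ring ring using (-1*x≈-x; -‿injective; -‿involutive; -0#≈0#; +-cancelˡ)
  open import Algebra.Properties.CommutativeSemigroup Poly.*-commutativeSemigroup using (x∙yz≈y∙xz)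
  private
    module ≈-Reasoning = Relation.Binary.Reasoning.Setoid setoid
    module ≈₁-Reasoning = Relation.Binary.Reasoning.Setoid Poly.setoid

  Y : Coeffs1
  Y (suc zero) = 1#
  Y _          = 0#

  C : Carrier → Coeffs1
  C x zero    = x
  C x (suc _) = 0#

  Deg≤ : ℕ → Coeffs1 → Set ℓa
  Deg≤ d f = ∀ i → d < i → f i ≈ 0#

  IsZero : Coeffs1 → Set ℓa
  IsZero f = ∀ i → f i ≈ 0#

  Y*-at0 : ∀ h → (Y *₁ h) 0 ≈ 0#
  Y*-at0 h = trans (+-identityˡ _) (zeroˡ _)

  Y*-suc : ∀ h i → (Y *₁ h) (suc i) ≈ h i
  Y*-suc h i = trans (sum-single (suc (suc i)) 1 _ (s≤s (s≤s z≤n)) Y-off) (*-identityˡ _)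
    where
      Y-off : ∀ j → j < suc (suc i) → j ≢ 1 → Y j * h (suc i ∸ j) ≈ 0#
      Y-off zero          _ _   = zeroˡ _
      Y-off (suc zero)    _ 1≢1 = contradiction Eq.refl 1≢1
      Y-off (suc (suc j)) _ _   = zeroˡ _

  C*-coeff : ∀ x h i → (C x *₁ h) i ≈ x * h i
  C*-coeff x h i = sum-single (suc i) 0 _ (s≤s z≤n) C-off
    where
      C-off : ∀ j → j < suc i → j ≢ 0 → C x j * h (i ∸ j) ≈ 0#
      C-off zero    _ 0≢0 = contradiction Eq.refl 0≢0
      C-off (suc j) _ _   = zeroˡ _

  x*ym1₀≈-x : ∀ x → x * ym1 0 ≈ - x
  x*ym1₀≈-x x = trans (*-comm x (- 1#)) (-1*x≈-x x)

  C*ym1^1-coeff : ∀ e i → (C e *₁ (ym1 ^₁ 1)) i ≈ e * ym1 i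
  C*ym1^1-coeff e i = trans (C*-coeff e (ym1 ^₁ 1) i) (*-congˡ (Poly.*-identityʳ ym1 i))

  *₁-at0 : ∀ f g → (f *₁ g) 0 ≈ f 0 * g 0
  *₁-at0 f g = +-identityˡ _

  ym1*-at0 : ∀ h → (ym1 *₁ h) 0 ≈ - h 0
  ym1*-at0 h = trans (+-identityˡ _) (-1*x≈-x _)

  ym1*-suc : ∀ h i → (ym1 *₁ h) (suc i) ≈ h i - h (suc i)
  ym1*-suc h i = begin
    sumR (suc (suc i)) (λ j → ym1 j * h (suc i ∸ j))
      ≈⟨ sum-unfoldˡ (suc i) _ ⟩
    - 1# * h (suc i) + sumR (suc i) (λ j → ym1 (suc j) * h (i ∸ j))
      ≈⟨ +-cong (-1*x≈-x _) (sum-unfoldˡ i _) ⟩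
    - h (suc i) + (1# * h i + sumR i (λ j → ym1 (suc (suc j)) * h (i ∸ suc j)))
      ≈⟨ +-congˡ (trans (+-cong (*-identityˡ _) (sum-zero i (λ _ _ → zeroˡ _))) (+-identityʳ _)) ⟩
    - h (suc i) + h i
      ≈⟨ +-comm _ _ ⟩
    h i - h (suc i) ∎
    where open ≈-Reasoning

  Y-cancel : ∀ f g → Y *₁ f ≈₁ Y *₁ g → f ≈₁ g
  Y-cancel f g Yf≈Yg i = trans (sym (Y*-suc f i)) (trans (Yf≈Yg (suc i)) (Y*-suc g i))

  ym1-cancel : ∀ f g → ym1 *₁ f ≈₁ ym1 *₁ g → f ≈₁ g
  ym1-cancel f g eq zero    = -‿injective (trans (sym (ym1*-at0 f)) (trans (eq 0) (ym1*-at0 g)))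
  ym1-cancel f g eq (suc i) = -‿injective (+-cancelˡ (f i) _ _ (begin
    f i - f (suc i)       ≈⟨ sym (ym1*-suc f i) ⟩
    (ym1 *₁ f) (suc i)    ≈⟨ eq (suc i) ⟩
    (ym1 *₁ g) (suc i)    ≈⟨ ym1*-suc g i ⟩
    g i - g (suc i)       ≈⟨ +-congʳ (sym (ym1-cancel f g eq i)) ⟩
    f i - g (suc i)       ∎))
    where open ≈-Reasoning

  ym1^-cancel : ∀ d f g → (ym1 ^₁ d) *₁ f ≈₁ (ym1 ^₁ d) *₁ g → f ≈₁ g
  ym1^-cancel zero    f g eq = Poly.trans (Poly.sym (*₁-identityˡ f)) (Poly.trans eq (*₁-identityˡ g))
  ym1^-cancel (suc d) f g eq = ym1^-cancel d f g (ym1-cancel _ _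
    (Poly.trans (Poly.sym (*₁-assoc ym1 (ym1 ^₁ d) f)) (Poly.trans eq (*₁-assoc ym1 (ym1 ^₁ d) g))))

  ^₁-+ : ∀ f m n → f ^₁ (m ℕ.+ n) ≈₁ (f ^₁ m) *₁ (f ^₁ n)
  ^₁-+ f zero    n = Poly.sym (*₁-identityˡ _)
  ^₁-+ f (suc m) n = Poly.trans (*₁-congˡ f (^₁-+ f m n)) (Poly.sym (*₁-assoc f (f ^₁ m) (f ^₁ n)))

  Y^-coeff-same : ∀ j → (Y ^₁ j) j ≈ 1#
  Y^-coeff-same zero    = refl
  Y^-coeff-same (suc j) = trans (Y*-suc (Y ^₁ j) j) (Y^-coeff-same j)

  Y^-coeff-other : ∀ j k → j ≢ k → (Y ^₁ j) k ≈ 0#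
  Y^-coeff-other zero    zero    0≢0 = contradiction Eq.refl 0≢0
  Y^-coeff-other zero    (suc k) _   = refl
  Y^-coeff-other (suc j) zero    _   = Y*-at0 (Y ^₁ j)
  Y^-coeff-other (suc j) (suc k) j≢k = trans (Y*-suc (Y ^₁ j) k) (Y^-coeff-other j k (j≢k ∘ Eq.cong suc))

  monoY≈Y^ : ∀ k → monoY k ≈₁ Y ^₁ k
  monoY≈Y^ k l with l ℕ.≟ k
  ... | yes Eq.refl = sym (Y^-coeff-same l)
  ... | no  l≢k     = sym (Y^-coeff-other k l (l≢k ∘ Eq.sym))

  Deg≤-mono : ∀ {d e f} → d ≤ e → Deg≤ d f → Deg≤ e f
  Deg≤-mono d≤e deg i e<i = deg i (ℕP.<-≤-trans (s≤s d≤e) e<i)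

  Deg≤-cong : ∀ {d f g} → f ≈₁ g → Deg≤ d f → Deg≤ d g
  Deg≤-cong f≈g deg i d<i = trans (sym (f≈g i)) (deg i d<i)

  Deg≤-pred : ∀ {d f} → Deg≤ (suc d) f → f (suc d) ≈ 0# → Deg≤ d f
  Deg≤-pred deg top≈0 i d<i with ℕP.m≤n⇒m<n∨m≡n d<i
  ... | inj₁ 1+d<i   = deg i 1+d<i
  ... | inj₂ Eq.refl = top≈0

  Deg≤0-zero : ∀ {f} → Deg≤ 0 f → f 0 ≈ 0# → IsZero f
  Deg≤0-zero deg f0≈0 zero    = f0≈0
  Deg≤0-zero deg f0≈0 (suc i) = deg (suc i) (s≤s z≤n)

  Deg≤-tail : ∀ {d h} → Deg≤ d h → Deg≤ d (h ∘ suc)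
  Deg≤-tail deg i d<i = deg (suc i) (ℕP.m<n⇒m<1+n d<i)

  Deg≤-* : ∀ {d e f g} → Deg≤ d f → Deg≤ e g → Deg≤ (d ℕ.+ e) (f *₁ g)
  Deg≤-* {d} {e} {f} {g} degf degg k d+e<k = sum-zero (suc k) term≈0
    where
      term≈0 : ∀ i → i < suc k → f i * g (k ∸ i) ≈ 0#
      term≈0 i _ with d ℕ.<? i
      ... | yes d<i = trans (*-congʳ (degf i d<i)) (zeroˡ _)
      ... | no  d≮i = trans (*-congˡ (degg (k ∸ i) (m≤n∧n+o<p⇒o<p∸m (ℕP.≮⇒≥ d≮i) d+e<k))) (zeroʳ _)

  leading-* : ∀ {d e f g} → Deg≤ d f → Deg≤ e g → (f *₁ g) (d ℕ.+ e) ≈ f d * g e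
  leading-* {d} {e} {f} {g} degf degg =
    trans (sum-single (suc (d ℕ.+ e)) d _ (s≤s (ℕP.m≤m+n d e)) off)
          (*-congˡ (reflexive (Eq.cong g (ℕP.m+n∸m≡n d e))))
    where
      off : ∀ i → i < suc (d ℕ.+ e) → i ≢ d → f i * g (d ℕ.+ e ∸ i) ≈ 0#
      off i _ i≢d with ℕP.<-cmp i d
      ... | tri< i<d _ _ =
        trans (*-congˡ (degg _ (m≤n∧n+o<p⇒o<p∸m ℕP.≤-refl (ℕP.+-monoˡ-< e i<d)))) (zeroʳ _)
      ... | tri≈ _ i≡d _ = contradiction i≡d i≢d
      ... | tri> _ _ d<i = trans (*-congʳ (degf i d<i)) (zeroˡ _)

  Deg≤-Y : Deg≤ 1 Y
  Deg≤-Y (suc (suc i)) _ = refl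
  Deg≤-Y (suc zero) (s≤s ())

  Deg≤-ym1 : Deg≤ 1 ym1
  Deg≤-ym1 (suc (suc i)) _ = refl
  Deg≤-ym1 (suc zero) (s≤s ())

  Deg≤-C : ∀ x → Deg≤ 0 (C x)
  Deg≤-C x (suc i) _ = refl

  Deg≤-^ : ∀ f k → Deg≤ 1 f → Deg≤ k (f ^₁ k)
  Deg≤-^ f zero    deg (suc i) _ = refl
  Deg≤-^ f (suc k) deg = Deg≤-* deg (Deg≤-^ f k deg)

  leading-^ : ∀ f k → Deg≤ 1 f → f 1 ≈ 1# → (f ^₁ k) k ≈ 1#
  leading-^ f zero    deg f1≈1 = refl
  leading-^ f (suc k) deg f1≈1 =
    trans (leading-* deg (Deg≤-^ f k deg)) (trans (*-cong f1≈1 (leading-^ f k deg f1≈1)) (*-identityˡ _))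

  sum-*₁ : ∀ {d e f g} N → Deg≤ d f → Deg≤ e g → d ℕ.+ e < N →
           sumR N (f *₁ g) ≈ sumR (suc d) f * sumR (suc e) g
  sum-*₁ {d} {e} {f} {g} N degf degg d+e<N = begin
    sumR N (f *₁ g)
      ≈⟨ sum-cauchy d e N (λ i j → f i * g j) (λ i j d<i → trans (*-congʳ (degf i d<i)) (zeroˡ _))
                    (λ i j e<j → trans (*-congˡ (degg j e<j)) (zeroʳ _)) d+e<N ⟩
    sumR (suc d) (λ i → sumR (suc e) (λ j → f i * g j))
      ≈⟨ sum-cong (suc d) (λ i → sym (*-distribˡ-sum (suc e) _ _)) ⟩
    sumR (suc d) (λ i → f i * sumR (suc e) g)
      ≈⟨ sym (*-distribʳ-sum (suc d) _ _) ⟩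
    sumR (suc d) f * sumR (suc e) g ∎
    where open ≈-Reasoning

  sum-ym1^suc : ∀ k N → suc k < N → sumR N (ym1 ^₁ suc k) ≈ 0#
  sum-ym1^suc k N 1+k<N = trans (sum-*₁ N Deg≤-ym1 (Deg≤-^ ym1 k Deg≤-ym1) 1+k<N)
                                (trans (*-congʳ (trans (+-congʳ (+-identityˡ _)) (-‿inverseˡ _))) (zeroˡ _))

  sum-Y^ : ∀ k N → k < N → sumR N (Y ^₁ k) ≈ 1#
  sum-Y^ zero    (suc N) _ = trans (sum-truncate 1 (suc N) _ (s≤s z≤n) (λ { (suc i) _ → refl })) (+-identityˡ _)
  sum-Y^ (suc k) N k<N = trans (sum-*₁ N Deg≤-Y (Deg≤-^ Y k Deg≤-Y) k<N)
                               (trans (*-cong (trans (+-congʳ (+-identityˡ _)) (+-identityˡ _)) (sum-Y^ k (suc k) ℕP.≤-refl))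
                                      (*-identityˡ _))

  Y-divides : ∀ h → h 0 ≈ 0# → h ≈₁ Y *₁ (h ∘ suc)
  Y-divides h h0≈0 zero    = trans h0≈0 (sym (Y*-at0 (h ∘ suc)))
  Y-divides h h0≈0 (suc i) = sym (Y*-suc (h ∘ suc) i)

  Ym1Divides : ℕ → Coeffs1 → Set (a ⊔ ℓa)
  Ym1Divides d h = Σ Coeffs1 λ h' → Deg≤ d h' × h ≈₁ ym1 *₁ h'

  ym1-quotient : Coeffs1 → Coeffs1
  ym1-quotient h i = - sumR (suc i) h

  -- as formal power series h = (y-1)·(-Σ partial sums of h); the quotient is a polynomial iff h(1) = 0
  ym1-quotient-spec : ∀ h → h ≈₁ ym1 *₁ ym1-quotient h
  ym1-quotient-spec h zero    = sym (trans (ym1*-at0 (ym1-quotient h)) (trans (-‿involutive _) (+-identityˡ _)))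
  ym1-quotient-spec h (suc i) = sym (begin
    (ym1 *₁ ym1-quotient h) (suc i)                    ≈⟨ ym1*-suc (ym1-quotient h) i ⟩
    - sumR (suc i) h - - (sumR (suc i) h + h (suc i))  ≈⟨ +-congˡ (-‿involutive _) ⟩
    - sumR (suc i) h + (sumR (suc i) h + h (suc i))    ≈⟨ sym (+-assoc _ _ _) ⟩
    (- sumR (suc i) h + sumR (suc i) h) + h (suc i)    ≈⟨ +-congʳ (-‿inverseˡ _) ⟩
    0# + h (suc i)                                     ≈⟨ +-identityˡ _ ⟩
    h (suc i)                                          ∎)
    where open ≈-Reasoning

  Deg≤-ym1-quotient : ∀ d h → Deg≤ d h → sumR (suc d) h ≈ 0# → Deg≤ d (ym1-quotient h)
  Deg≤-ym1-quotient d h degh h1≈0 i d<i =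
    trans (-‿cong (trans (sum-truncate (suc d) (suc i) h (ℕP.m<n⇒m<1+n d<i) degh) h1≈0)) -0#≈0#

  ym1-divides : ∀ d h → Deg≤ d h → sumR (suc d) h ≈ 0# → Ym1Divides d h
  ym1-divides d h degh h1≈0 = ym1-quotient h , Deg≤-ym1-quotient d h degh h1≈0 , ym1-quotient-spec h

  ym1-cancelˡ : ∀ f f' g h → f ≈₁ ym1 *₁ f' → f *₁ g ≈₁ ym1 *₁ h → f' *₁ g ≈₁ h
  ym1-cancelˡ f f' g h f≈ym1f' fg≈ym1h =
    ym1-cancel _ _ (Poly.trans (Poly.sym (*₁-assoc ym1 f' g)) (Poly.trans (*₁-congʳ g (Poly.sym f≈ym1f')) fg≈ym1h))

  ym1-cancelʳ : ∀ f g g' h → g ≈₁ ym1 *₁ g' → f *₁ g ≈₁ ym1 *₁ h → f *₁ g' ≈₁ h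
  ym1-cancelʳ f g g' h g≈ym1g' fg≈ym1h =
    ym1-cancel _ _ (Poly.trans (x∙yz≈y∙xz ym1 f g') (Poly.trans (*₁-congˡ f (Poly.sym g≈ym1g')) fg≈ym1h))

  scaledPow : Carrier → ℕ → ℕ → Coeffs1
  scaledPow x p m = C x *₁ ((Y ^₁ p) *₁ (ym1 ^₁ m))

  Deg≤-scaledPow : ∀ x p m → Deg≤ (p ℕ.+ m) (scaledPow x p m)
  Deg≤-scaledPow x p m = Deg≤-* (Deg≤-C x) (Deg≤-* (Deg≤-^ Y p Deg≤-Y) (Deg≤-^ ym1 m Deg≤-ym1))

  scaledPow-suc-Y : ∀ x p m → scaledPow x (suc p) m ≈₁ Y *₁ scaledPow x p m
  scaledPow-suc-Y x p m =
    Poly.trans (*₁-congˡ (C x) (*₁-assoc Y (Y ^₁ p) (ym1 ^₁ m))) (x∙yz≈y∙xz (C x) Y ((Y ^₁ p) *₁ (ym1 ^₁ m)))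

  scaledPow-suc-ym1 : ∀ x p m → scaledPow x p (suc m) ≈₁ ym1 *₁ scaledPow x p m
  scaledPow-suc-ym1 x p m =
    Poly.trans (*₁-congˡ (C x) (x∙yz≈y∙xz (Y ^₁ p) ym1 (ym1 ^₁ m))) (x∙yz≈y∙xz (C x) ym1 ((Y ^₁ p) *₁ (ym1 ^₁ m)))

  scaledPow-ym1^ : ∀ x p d m → scaledPow x p (d ℕ.+ m) ≈₁ (ym1 ^₁ d) *₁ scaledPow x p m
  scaledPow-ym1^ x p zero    m = Poly.sym (*₁-identityˡ (scaledPow x p m))
  scaledPow-ym1^ x p (suc d) m =
    Poly.trans (scaledPow-suc-ym1 x p (d ℕ.+ m))
    (Poly.trans (*₁-congˡ ym1 (scaledPow-ym1^ x p d m)) (Poly.sym (*₁-assoc ym1 (ym1 ^₁ d) (scaledPow x p m))))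

  leading-scaledPow : ∀ x p m → scaledPow x p m (p ℕ.+ m) ≈ x
  leading-scaledPow x p m =
    trans (C*-coeff x ((Y ^₁ p) *₁ (ym1 ^₁ m)) (p ℕ.+ m))
    (trans (*-congˡ (trans (leading-* (Deg≤-^ Y p Deg≤-Y) (Deg≤-^ ym1 m Deg≤-ym1))
                           (*-cong (leading-^ Y p Deg≤-Y refl) (leading-^ ym1 m Deg≤-ym1 refl))))
    (trans (*-congˡ (*-identityʳ 1#)) (*-identityʳ x)))

  scaledPow-degree : ∀ {d e f g} x p m → Deg≤ d f → Deg≤ e g → x ≉ 0# → f *₁ g ≈₁ scaledPow x p m →
                     p ℕ.+ m ≤ d ℕ.+ e
  scaledPow-degree {d} {e} x p m degf degg x≉0 fg≈ with p ℕ.+ m ℕ.≤? d ℕ.+ e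
  ... | yes p+m≤d+e = p+m≤d+e
  ... | no  p+m≰d+e = contradiction
    (trans (sym (leading-scaledPow x p m)) (trans (sym (fg≈ (p ℕ.+ m))) (Deg≤-* degf degg _ (ℕP.≰⇒> p+m≰d+e)))) x≉0

  sum-ym1^suc-* : ∀ {d f} k N → Deg≤ d f → suc k ℕ.+ d < N → sumR N ((ym1 ^₁ suc k) *₁ f) ≈ 0#
  sum-ym1^suc-* {d} {f} k N degf k+d<N =
    trans (sum-*₁ N (Deg≤-^ ym1 (suc k) Deg≤-ym1) degf k+d<N)
          (trans (*-congʳ (sum-ym1^suc k (suc (suc k)) ℕP.≤-refl)) (zeroˡ _))

  sum-scaledPow-zeroʳ : ∀ x p N → p < N → sumR N (scaledPow x p 0) ≈ x
  sum-scaledPow-zeroʳ x p N p<N = begin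
    sumR N (scaledPow x p 0)               ≈⟨ sum-cong N (*₁-congˡ (C x) (Poly.*-identityʳ (Y ^₁ p))) ⟩
    sumR N (C x *₁ (Y ^₁ p))               ≈⟨ sum-*₁ N (Deg≤-C x) (Deg≤-^ Y p Deg≤-Y) p<N ⟩
    sumR 1 (C x) * sumR (suc p) (Y ^₁ p)   ≈⟨ *-cong (+-identityˡ x) (sum-Y^ p (suc p) ℕP.≤-refl) ⟩
    x * 1#                                 ≈⟨ *-identityʳ x ⟩
    x                                      ∎
    where open ≈-Reasoning

  C*ym1^-degree : ∀ {d} x k → Deg≤ d (C x *₁ (ym1 ^₁ k)) → (C x *₁ (ym1 ^₁ k)) 0 ≉ 0# → k ≤ d
  C*ym1^-degree {d} x k deg f0≉0 with k ℕ.≤? d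
  ... | yes k≤d = k≤d
  ... | no  k≰d = contradiction (trans (C*-coeff x (ym1 ^₁ k) 0) (trans (*-congʳ x≈0) (zeroˡ _))) f0≉0
    where
      x≈0 : x ≈ 0#
      x≈0 = begin
        x                          ≈⟨ sym (*-identityʳ x) ⟩
        x * 1#                     ≈⟨ *-congˡ (sym (leading-^ ym1 k Deg≤-ym1 refl)) ⟩
        x * (ym1 ^₁ k) k           ≈⟨ sym (C*-coeff x (ym1 ^₁ k) k) ⟩
        (C x *₁ (ym1 ^₁ k)) k      ≈⟨ deg k (ℕP.≰⇒> k≰d) ⟩
        0#                         ∎
        where open ≈-Reasoning


module UnivariateDomain {a ℓa : Level} (A : CommutativeRing a ℓa) (dom : Over.IsIntegralDomain A) where
  open CommutativeRing A hiding (zero)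
  open Over A
  open Sums A
  open Convolution A
  open Univariate A
  open import Algebra.Properties.Ring ring using (-‿injective; -0#≈0#)
  open import Algebra.Properties.CommutativeSemigroup Poly.*-commutativeSemigroup using (x∙yz≈y∙xz)
  private
    module ≈-Reasoning = Relation.Binary.Reasoning.Setoid setoid
    module ≈₁-Reasoning = Relation.Binary.Reasoning.Setoid Poly.setoid

  x*y≈0⇒x≈0∨y≈0 : ∀ x y → x * y ≈ 0# → x ≈ 0# ⊎ y ≈ 0#
  x*y≈0⇒x≈0∨y≈0 = proj₂ dom

  x≉0∧y≉0⇒x*y≉0 : ∀ {x y} → x ≉ 0# → y ≉ 0# → x * y ≉ 0#
  x≉0∧y≉0⇒x*y≉0 x≉0 y≉0 xy≈0 with x*y≈0⇒x≈0∨y≈0 _ _ xy≈0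
  ... | inj₁ x≈0 = x≉0 x≈0
  ... | inj₂ y≈0 = y≉0 y≈0

  x≉0⇒-x≉0 : ∀ {x} → x ≉ 0# → - x ≉ 0#
  x≉0⇒-x≉0 {x} x≉0 -x≈0 = x≉0 (-‿injective (trans -x≈0 (sym -0#≈0#)))

  *₁-noZeroDivisors : ∀ d e f g → Deg≤ d f → Deg≤ e g → IsZero (f *₁ g) → IsZero f ⊎ IsZero g
  *₁-noZeroDivisors d e f g degf degg fg≈0
    with x*y≈0⇒x≈0∨y≈0 (f d) (g e) (trans (sym (leading-* degf degg)) (fg≈0 (d ℕ.+ e)))
  *₁-noZeroDivisors zero    e f g degf degg fg≈0 | inj₁ fd≈0 = inj₁ (Deg≤0-zero degf fd≈0)
  *₁-noZeroDivisors (suc d) e f g degf degg fg≈0 | inj₁ fd≈0 =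
    *₁-noZeroDivisors d e f g (Deg≤-pred degf fd≈0) degg fg≈0
  *₁-noZeroDivisors d zero    f g degf degg fg≈0 | inj₂ ge≈0 = inj₂ (Deg≤0-zero degg ge≈0)
  *₁-noZeroDivisors d (suc e) f g degf degg fg≈0 | inj₂ ge≈0 =
    *₁-noZeroDivisors d e f g degf (Deg≤-pred degg ge≈0) fg≈0

  Deg≤-factor : ∀ d e D f g → Deg≤ d f → Deg≤ e g → Deg≤ D (f *₁ g) → ¬ IsZero g → Deg≤ D f
  Deg≤-factor d e D f g degf degg degfg g≉0 with d ℕ.≤? D
  ... | yes d≤D = Deg≤-mono d≤D degf
  ... | no  d≰D with x*y≈0⇒x≈0∨y≈0 (f d) (g e) (trans (sym (leading-* degf degg))
                       (degfg (d ℕ.+ e) (ℕP.<-≤-trans (ℕP.≰⇒> d≰D) (ℕP.m≤m+n d e))))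
  Deg≤-factor zero    e D f g degf degg degfg g≉0 | no d≰D | inj₁ _     = contradiction z≤n d≰D
  Deg≤-factor (suc d) e D f g degf degg degfg g≉0 | no _   | inj₁ fd≈0 =
    Deg≤-factor d e D f g (Deg≤-pred degf fd≈0) degg degfg g≉0
  Deg≤-factor d zero    D f g degf degg degfg g≉0 | no _   | inj₂ ge≈0 = contradiction (Deg≤0-zero degg ge≈0) g≉0
  Deg≤-factor d (suc e) D f g degf degg degfg g≉0 | no _   | inj₂ ge≈0 =
    Deg≤-factor d e D f g degf (Deg≤-pred degg ge≈0) degfg g≉0

  ym1^-at0≉0 : ∀ k → (ym1 ^₁ k) 0 ≉ 0#
  ym1^-at0≉0 zero    = proj₁ dom
  ym1^-at0≉0 (suc k) = x≉0⇒-x≉0 (ym1^-at0≉0 k) ∘ trans (sym (ym1*-at0 (ym1 ^₁ k)))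

  ym1-prime : ∀ d e D f g h → Deg≤ d f → Deg≤ e g → Deg≤ D h → f *₁ g ≈₁ ym1 *₁ h →
              Ym1Divides d f ⊎ Ym1Divides e g
  ym1-prime d e D f g h degf degg degh fg≈ym1*h with x*y≈0⇒x≈0∨y≈0 (sumR (suc d) f) (sumR (suc e) g) f1*g1≈0
    where
      open ≈-Reasoning
      N : ℕ
      N = suc (d ℕ.+ e ℕ.+ suc D)
      f1*g1≈0 : sumR (suc d) f * sumR (suc e) g ≈ 0#
      f1*g1≈0 = begin
        sumR (suc d) f * sumR (suc e) g      ≈⟨ sym (sum-*₁ N degf degg (s≤s (ℕP.m≤m+n _ _))) ⟩
        sumR N (f *₁ g)                      ≈⟨ sum-cong N fg≈ym1*h ⟩
        sumR N (ym1 *₁ h)                    ≈⟨ sum-*₁ N Deg≤-ym1 degh (s≤s (ℕP.m≤n+m _ _)) ⟩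
        sumR 2 ym1 * sumR (suc D) h          ≈⟨ *-congʳ (trans (+-congʳ (+-identityˡ _)) (-‿inverseˡ _)) ⟩
        0# * sumR (suc D) h                  ≈⟨ zeroˡ _ ⟩
        0#                                   ∎
  ... | inj₁ f1≈0 = inj₁ (ym1-divides d f degf f1≈0)
  ... | inj₂ g1≈0 = inj₂ (ym1-divides e g degg g1≈0)

  divisor-of-constant : ∀ d e x f g → Deg≤ d f → Deg≤ e g → x ≉ 0# → f *₁ g ≈₁ C x → f ≈₁ C (f 0)
  divisor-of-constant d e x f g degf degg x≉0 fg≈x = f≈C
    where
      g≉0 : ¬ IsZero g
      g≉0 g≈0 = x≉0 (trans (sym (fg≈x 0)) (trans (*₁-at0 f g) (trans (*-congˡ (g≈0 0)) (zeroʳ _))))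
      degf0 : Deg≤ 0 f
      degf0 = Deg≤-factor d e 0 f g degf degg (Deg≤-cong (Poly.sym fg≈x) (Deg≤-C x)) g≉0
      f≈C : f ≈₁ C (f 0)
      f≈C zero    = refl
      f≈C (suc i) = degf0 (suc i) (s≤s z≤n)

  strip-Y : ∀ f g h → f 0 ≉ 0# → f *₁ g ≈₁ Y *₁ h → f *₁ (g ∘ suc) ≈₁ h
  strip-Y f g h f0≉0 fg≈Yh = Y-cancel _ _ (begin
    Y *₁ (f *₁ (g ∘ suc))   ≈⟨ x∙yz≈y∙xz Y f (g ∘ suc) ⟩
    f *₁ (Y *₁ (g ∘ suc))   ≈⟨ *₁-congˡ f (Poly.sym (Y-divides g g0≈0)) ⟩
    f *₁ g                  ≈⟨ fg≈Yh ⟩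
    Y *₁ h                  ∎)
    where
      open ≈₁-Reasoning
      g0≈0 : g 0 ≈ 0#
      g0≈0 with x*y≈0⇒x≈0∨y≈0 (f 0) (g 0) (trans (sym (*₁-at0 f g)) (trans (fg≈Yh 0) (Y*-at0 h)))
      ... | inj₁ f0≈0 = contradiction f0≈0 f0≉0
      ... | inj₂ g0≈0 = g0≈0

  -- peel off the factors y (f(0) ≠ 0 pushes them into g) and y-1 (prime, by evaluating at y = 1)
  divisor-of-scaledPow : ∀ p m x f g d e → Deg≤ d f → Deg≤ e g → x ≉ 0# → f 0 ≉ 0# →
    f *₁ g ≈₁ scaledPow x p m → Σ ℕ λ k → Σ Carrier λ c → k ≤ m × f ≈₁ C c *₁ (ym1 ^₁ k)
  divisor-of-scaledPow (suc p) m x f g d e degf degg x≉0 f0≉0 fg≈ =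
    divisor-of-scaledPow p m x f (g ∘ suc) d e degf (Deg≤-tail degg) x≉0 f0≉0
      (strip-Y f g _ f0≉0 (Poly.trans fg≈ (scaledPow-suc-Y x p m)))
  divisor-of-scaledPow zero (suc m) x f g d e degf degg x≉0 f0≉0 fg≈
    with ym1-prime d e m f g _ degf degg (Deg≤-scaledPow x 0 m) (Poly.trans fg≈ (scaledPow-suc-ym1 x 0 m))
  ... | inj₁ (f' , degf' , f≈ym1f') =
    let (k , c , k≤m , f'≈) = divisor-of-scaledPow zero m x f' g d e degf' degg x≉0 f'0≉0
                                (ym1-cancelˡ f f' g _ f≈ym1f' (Poly.trans fg≈ (scaledPow-suc-ym1 x 0 m)))
    in suc k , c , s≤s k≤m ,
       Poly.trans f≈ym1f' (Poly.trans (*₁-congˡ ym1 f'≈) (x∙yz≈y∙xz ym1 (C c) (ym1 ^₁ k)))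
    where
      f'0≉0 : f' 0 ≉ 0#
      f'0≉0 f'0≈0 = f0≉0 (trans (f≈ym1f' 0) (trans (ym1*-at0 f') (trans (-‿cong f'0≈0) -0#≈0#)))
  ... | inj₂ (g' , degg' , g≈ym1g') =
    let (k , c , k≤m , f≈) = divisor-of-scaledPow zero m x f g' d e degf degg' x≉0 f0≉0
                               (ym1-cancelʳ f g g' _ g≈ym1g' (Poly.trans fg≈ (scaledPow-suc-ym1 x 0 m)))
    in k , c , ℕP.m≤n⇒m≤1+n k≤m , f≈
  divisor-of-scaledPow zero zero x f g d e degf degg x≉0 f0≉0 fg≈ =
    0 , f 0 , z≤n ,
    Poly.trans (divisor-of-constant d e x f g degf degg x≉0
                  (Poly.trans fg≈ (Poly.trans (*₁-congˡ (C x) (*₁-identityˡ one₁)) (Poly.*-identityʳ (C x)))))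
               (Poly.sym (Poly.*-identityʳ (C (f 0))))

module Bivariate {a ℓa : Level} (A : CommutativeRing a ℓa) where
  open CommutativeRing A hiding (zero)
  open Over A
  open Sums A
  open Convolution A
  open Univariate A
    using (Y; C; Deg≤; C*-coeff; Y*-at0; *₁-at0; ^₁-+; Deg≤-mono; Deg≤-*; Deg≤-^; Deg≤-Y; Deg≤-ym1; monoY≈Y^;
           Y^-coeff-same; Y^-coeff-other; sum-*₁)
  open import Algebra.Properties.CommutativeSemigroup Poly.*-commutativeSemigroup using (interchange; x∙yz≈y∙xz)
  module X = Univariate A[y]
  private
    module XC = Convolution A[y]
    module ≈₁-Reasoning = Relation.Binary.Reasoning.Setoid Poly.setoid
    module Sums₁ = Sums A[y]
  open XC public using () renaming (_≈₁_ to _≈ₓ_)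
  open Over A[y] public using () renaming (_*₁_ to _*ₓ_)

  row : Poly2 → ℕ → Coeffs1
  row P i j = coeff P i j

  DegX≤ : ℕ → Poly2 → Set ℓa
  DegX≤ α P = X.Deg≤ α (row P)

  DegY≤ : ℕ → Poly2 → Set ℓa
  DegY≤ β P = ∀ i → Deg≤ β (row P i)

  DegX≤-bound : ∀ P → DegX≤ (bound P) P
  DegX≤-bound P i α<i j = bounded P i j (inj₁ α<i)

  DegY≤-bound : ∀ P → DegY≤ (bound P) P
  DegY≤-bound P i j β<j = bounded P i j (inj₂ β<j)

  row≈C : ∀ P → DegY≤ 0 P → ∀ i → row P i ≈₁ C (coeff P i 0)
  row≈C P degY i zero    = refl
  row≈C P degY i (suc j) = degY i (suc j) (s≤s z≤n)

  constant-if-DegX≤0-DegY≤0 : ∀ V → DegX≤ 0 V → DegY≤ 0 V → IsConstant V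
  constant-if-DegX≤0-DegY≤0 V degX degY zero    (suc j) _ = degY 0 (suc j) (s≤s z≤n)
  constant-if-DegX≤0-DegY≤0 V degX degY (suc i) j       _ = degX (suc i) (s≤s z≤n) j

  VanishesAtX1 : ℕ → Poly2 → Set ℓa
  VanishesAtX1 N T = ∀ j → sumR N (λ i → coeff T i j) ≈ 0#

  VanishesAtY1 : ℕ → Poly2 → Set ℓa
  VanishesAtY1 N T = ∀ i → sumR N (λ j → coeff T i j) ≈ 0#

  DegX≤-⊓ : ∀ α β P → DegX≤ α P → DegX≤ β P → DegX≤ (α ℕ.⊓ β) P
  DegX≤-⊓ α β P degα degβ with ℕP.⊓-sel α β
  ... | inj₁ α⊓β≡α rewrite α⊓β≡α = degα
  ... | inj₂ α⊓β≡β rewrite α⊓β≡β = degβ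

  DegY≤-⊓ : ∀ α β P → DegY≤ α P → DegY≤ β P → DegY≤ (α ℕ.⊓ β) P
  DegY≤-⊓ α β P degα degβ with ℕP.⊓-sel α β
  ... | inj₁ α⊓β≡α rewrite α⊓β≡α = degα
  ... | inj₂ α⊓β≡β rewrite α⊓β≡β = degβ

  IsZero₂ : Poly2 → Set ℓa
  IsZero₂ P = ∀ i j → coeff P i j ≈ 0#

  transpose : Poly2 → Poly2
  transpose P = record { coeff = λ i j → coeff P j i ; bound = bound P ; bounded = λ i j → bounded P j i ∘ swap }

  sum₁-coeff : ∀ n (F : ℕ → Coeffs1) j → Over.sumR A[y] n F j ≈ sumR n (λ i → F i j)
  sum₁-coeff zero    F j = refl
  sum₁-coeff (suc n) F j = +-congʳ (sum₁-coeff n F j)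

  IsProduct⇒row-* : ∀ T U V → IsProduct T U V → row T ≈ₓ row U *ₓ row V
  IsProduct⇒row-* T U V T≈UV i j = trans (T≈UV i j) (sym (sum₁-coeff (suc i) _ j))

  row-*⇒IsProduct : ∀ T U V → row T ≈ₓ row U *ₓ row V → IsProduct T U V
  row-*⇒IsProduct T U V rows i j = trans (rows i j) (sum₁-coeff (suc i) _ j)

  IsProduct-comm : ∀ T U V → IsProduct T U V → IsProduct T V U
  IsProduct-comm T U V T≈UV =
    row-*⇒IsProduct T V U (λ i → Poly.trans (IsProduct⇒row-* T U V T≈UV i) (XC.*₁-comm (row U) (row V) i))

  IsProduct-transpose : ∀ T U V → IsProduct T U V → IsProduct (transpose T) (transpose U) (transpose V)
  IsProduct-transpose T U V T≈UV i j = trans (T≈UV j i) (sum-swap (suc j) (suc i) _)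

  mulCoeff-zeroˡ : ∀ U V → IsZero₂ U → ∀ i j → mulCoeff U V i j ≈ 0#
  mulCoeff-zeroˡ U V U≈0 i j =
    sum-zero (suc i) (λ a _ → sum-zero (suc j) (λ b _ → trans (*-congʳ (U≈0 a b)) (zeroˡ _)))

  mulCoeff-zeroʳ : ∀ U V → IsZero₂ V → ∀ i j → mulCoeff U V i j ≈ 0#
  mulCoeff-zeroʳ U V V≈0 i j =
    sum-zero (suc i) (λ a _ → sum-zero (suc j) (λ b _ → trans (*-congˡ (V≈0 _ _)) (zeroʳ _)))

  DegX≤-* : ∀ T U V {αU αV} → IsProduct T U V → DegX≤ αU U → DegX≤ αV V → DegX≤ (αU ℕ.+ αV) T
  DegX≤-* T U V T≈UV degU degV = X.Deg≤-cong (Poly.sym ∘ IsProduct⇒row-* T U V T≈UV) (X.Deg≤-* degU degV)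

  top-row : ∀ T U V {αU αV} → IsProduct T U V → DegX≤ αU U → DegX≤ αV V →
            row T (αU ℕ.+ αV) ≈₁ row U αU *₁ row V αV
  top-row T U V T≈UV degU degV = Poly.trans (IsProduct⇒row-* T U V T≈UV _) (X.leading-* degU degV)


  weight : ℕ → ℕ → Coeffs1
  weight α i = (Y ^₁ i) *₁ (ym1 ^₁ (α ∸ i))

  -- Q_α(P) = (y-1)^α · P(y/(y-1), y), a polynomial in y as soon as deg_x P ≤ α
  clearedSubst : ℕ → Poly2 → Coeffs1
  clearedSubst α P = Over.sumR A[y] (suc α) (λ i → row P i *₁ weight α i)

  weight-+ : ∀ {αU αV p q} → p ≤ αU → q ≤ αV → weight (αU ℕ.+ αV) (p ℕ.+ q) ≈₁ weight αU p *₁ weight αV q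
  weight-+ {αU} {αV} {p} {q} p≤αU q≤αV = begin
    (Y ^₁ (p ℕ.+ q)) *₁ (ym1 ^₁ ((αU ℕ.+ αV) ∸ (p ℕ.+ q)))
      ≈⟨ *₁-congʳ (ym1 ^₁ ((αU ℕ.+ αV) ∸ (p ℕ.+ q))) (^₁-+ Y p q) ⟩
    ((Y ^₁ p) *₁ (Y ^₁ q)) *₁ (ym1 ^₁ ((αU ℕ.+ αV) ∸ (p ℕ.+ q)))
      ≈⟨ *₁-congˡ ((Y ^₁ p) *₁ (Y ^₁ q))
           (Poly.trans (Poly.reflexive (Eq.cong (ym1 ^₁_) (+-∸-interchange p≤αU q≤αV))) (^₁-+ ym1 (αU ∸ p) (αV ∸ q))) ⟩
    ((Y ^₁ p) *₁ (Y ^₁ q)) *₁ ((ym1 ^₁ (αU ∸ p)) *₁ (ym1 ^₁ (αV ∸ q)))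
      ≈⟨ interchange (Y ^₁ p) (Y ^₁ q) (ym1 ^₁ (αU ∸ p)) (ym1 ^₁ (αV ∸ q)) ⟩
    weight αU p *₁ weight αV q ∎
    where open ≈₁-Reasoning

  clearedSubst-* : ∀ T U V αU αV → IsProduct T U V → DegX≤ αU U → DegX≤ αV V →
                   clearedSubst (αU ℕ.+ αV) T ≈₁ clearedSubst αU U *₁ clearedSubst αV V
  clearedSubst-* T U V αU αV T≈UV degU degV = begin
    Over.sumR A[y] (suc α) (λ i → row T i *₁ weight α i)
      ≈⟨ Sums₁.sum-cong (suc α) (λ i → Poly.trans (*₁-congʳ (weight α i) (IsProduct⇒row-* T U V T≈UV i))
                                                  (Sums₁.*-distribʳ-sum (suc i) (weight α i) (λ p → row U p *₁ row V (i ∸ p)))) ⟩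
    Over.sumR A[y] (suc α) (λ i → Over.sumR A[y] (suc i) (λ p → (row U p *₁ row V (i ∸ p)) *₁ weight α i))
      ≈⟨ Sums₁.sum-cong (suc α) (λ i → Sums₁.sum-cong-< (suc i) (λ p p<1+i → term≈H (ℕP.≤-pred p<1+i))) ⟩
    Over.sumR A[y] (suc α) (λ i → Over.sumR A[y] (suc i) (λ p → H p (i ∸ p)))
      ≈⟨ Sums₁.sum-cauchy αU αV (suc α) H H≈0ˡ H≈0ʳ ℕP.≤-refl ⟩
    Over.sumR A[y] (suc αU) (λ p → Over.sumR A[y] (suc αV) (H p))
      ≈⟨ Sums₁.sum-cong (suc αU) (λ p →
           Poly.sym (Sums₁.*-distribˡ-sum (suc αV) (row U p *₁ weight αU p) (λ q → row V q *₁ weight αV q))) ⟩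
    Over.sumR A[y] (suc αU) (λ p → (row U p *₁ weight αU p) *₁ clearedSubst αV V)
      ≈⟨ Poly.sym (Sums₁.*-distribʳ-sum (suc αU) (clearedSubst αV V) (λ p → row U p *₁ weight αU p)) ⟩
    clearedSubst αU U *₁ clearedSubst αV V ∎
    where
      open ≈₁-Reasoning
      α : ℕ
      α = αU ℕ.+ αV
      H : ℕ → ℕ → Coeffs1
      H p q = (row U p *₁ weight αU p) *₁ (row V q *₁ weight αV q)
      H≈0ˡ : ∀ p q → αU < p → H p q ≈₁ 0₁
      H≈0ˡ p q αU<p = *₁-zeroˡ _ (row V q *₁ weight αV q) (*₁-zeroˡ (row U p) (weight αU p) (degU p αU<p))
      H≈0ʳ : ∀ p q → αV < q → H p q ≈₁ 0₁
      H≈0ʳ p q αV<q = *₁-zeroʳ (row U p *₁ weight αU p) _ (*₁-zeroˡ (row V q) (weight αV q) (degV q αV<q))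
      term≈H : ∀ {i p} → p ≤ i → (row U p *₁ row V (i ∸ p)) *₁ weight α i ≈₁ H p (i ∸ p)
      term≈H {i} {p} p≤i with αU ℕ.<? p | αV ℕ.<? (i ∸ p)
      ... | yes αU<p | _ = Poly.trans (*₁-zeroˡ _ (weight α i) (*₁-zeroˡ (row U p) (row V (i ∸ p)) (degU p αU<p)))
                                      (Poly.sym (H≈0ˡ p (i ∸ p) αU<p))
      ... | no _ | yes αV<q = Poly.trans (*₁-zeroˡ _ (weight α i) (*₁-zeroʳ (row U p) (row V (i ∸ p)) (degV (i ∸ p) αV<q)))
                                         (Poly.sym (H≈0ʳ p (i ∸ p) αV<q))
      ... | no αU≮p | no αV≮q = begin
        (row U p *₁ row V (i ∸ p)) *₁ weight α i
          ≈⟨ *₁-congˡ (row U p *₁ row V (i ∸ p))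
               (Poly.trans (Poly.reflexive (Eq.cong (weight α) (Eq.sym (ℕP.m+[n∸m]≡n p≤i))))
                           (weight-+ (ℕP.≮⇒≥ αU≮p) (ℕP.≮⇒≥ αV≮q))) ⟩
        (row U p *₁ row V (i ∸ p)) *₁ (weight αU p *₁ weight αV (i ∸ p))
          ≈⟨ interchange (row U p) (row V (i ∸ p)) (weight αU p) (weight αV (i ∸ p)) ⟩
        H p (i ∸ p) ∎

  Deg≤-sum : ∀ d n (F : ℕ → Coeffs1) → (∀ i → i < n → Deg≤ d (F i)) → Deg≤ d (Over.sumR A[y] n F)
  Deg≤-sum d n F degF j d<j = trans (sum₁-coeff n F j) (sum-zero n (λ i i<n → degF i i<n j d<j))

  Deg≤-weight : ∀ α i → i ≤ α → Deg≤ α (weight α i)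
  Deg≤-weight α i i≤α =
    Deg≤-mono (ℕP.≤-reflexive (ℕP.m+[n∸m]≡n i≤α)) (Deg≤-* (Deg≤-^ Y i Deg≤-Y) (Deg≤-^ ym1 (α ∸ i) Deg≤-ym1))

  Deg≤-clearedSubst : ∀ α β P → DegY≤ β P → Deg≤ (α ℕ.+ β) (clearedSubst α P)
  Deg≤-clearedSubst α β P degY = Deg≤-sum (α ℕ.+ β) (suc α) _ (λ i i<1+α →
    Deg≤-mono (ℕP.≤-reflexive (ℕP.+-comm β α)) (Deg≤-* (degY i) (Deg≤-weight α i (ℕP.≤-pred i<1+α))))

  clearedSubst-at0 : ∀ α P → clearedSubst α P 0 ≈ coeff P 0 0 * (ym1 ^₁ α) 0
  clearedSubst-at0 α P =
    trans (sum₁-coeff (suc α) _ 0)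
    (trans (sum-single (suc α) 0 _ (s≤s z≤n) off)
    (trans (*₁-at0 (row P 0) (weight α 0)) (*-congˡ (trans (*₁-at0 one₁ (ym1 ^₁ α)) (*-identityˡ _)))))
    where
      off : ∀ i → i < suc α → i ≢ 0 → (row P i *₁ weight α i) 0 ≈ 0#
      off zero    _ 0≢0 = contradiction Eq.refl 0≢0
      off (suc i) _ _   = trans (*₁-at0 (row P (suc i)) (weight α (suc i)))
        (trans (*-congˡ (trans (*₁-assoc Y (Y ^₁ i) (ym1 ^₁ (α ∸ suc i)) 0) (Y*-at0 ((Y ^₁ i) *₁ (ym1 ^₁ (α ∸ suc i))))))
               (zeroʳ _))

  clearedSubst-suc : ∀ α P → DegX≤ α P → clearedSubst (suc α) P ≈₁ ym1 *₁ clearedSubst α P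
  clearedSubst-suc α P degX =
    Poly.trans (Poly.+-congˡ (*₁-zeroˡ (row P (suc α)) (weight (suc α) (suc α)) (degX (suc α) ℕP.≤-refl)))
    (Poly.trans (Poly.+-identityʳ _)
    (Poly.trans (Sums₁.sum-cong-< (suc α) (λ i i<1+α → term (ℕP.≤-pred i<1+α)))
                (Poly.sym (Sums₁.*-distribˡ-sum (suc α) ym1 (λ i → row P i *₁ weight α i)))))
    where
      term : ∀ {i} → i ≤ α → row P i *₁ weight (suc α) i ≈₁ ym1 *₁ (row P i *₁ weight α i)
      term {i} i≤α = Poly.trans
        (*₁-congˡ (row P i) (Poly.trans (*₁-congˡ (Y ^₁ i) (Poly.reflexive (Eq.cong (ym1 ^₁_) (ℕP.+-∸-assoc 1 i≤α))))
                                        (x∙yz≈y∙xz (Y ^₁ i) ym1 (ym1 ^₁ (α ∸ i)))))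
        (x∙yz≈y∙xz (row P i) ym1 (weight α i))

  clearedSubst-+ : ∀ α d P → DegX≤ α P → clearedSubst (α ℕ.+ d) P ≈₁ (ym1 ^₁ d) *₁ clearedSubst α P
  clearedSubst-+ α zero P degX =
    Poly.trans (Poly.reflexive (Eq.cong (λ k → clearedSubst k P) (ℕP.+-identityʳ α))) (Poly.sym (*₁-identityˡ _))
  clearedSubst-+ α (suc d) P degX =
    Poly.trans (Poly.reflexive (Eq.cong (λ k → clearedSubst k P) (ℕP.+-suc α d)))
    (Poly.trans (clearedSubst-suc (α ℕ.+ d) P (X.Deg≤-mono (ℕP.m≤m+n α d) degX))
    (Poly.trans (*₁-congˡ ym1 (clearedSubst-+ α d P degX)) (Poly.sym (*₁-assoc ym1 (ym1 ^₁ d) (clearedSubst α P)))))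

  row-expansion : ∀ B P i → DegY≤ B P → row P i ≈₁ Over.sumR A[y] (suc B) (λ j → C (coeff P i j) *₁ (Y ^₁ j))
  row-expansion B P i degY k =
    sym (trans (sum₁-coeff (suc B) _ k) (trans (sum-cong (suc B) (λ j → C*-coeff (coeff P i j) (Y ^₁ j) k)) expand))
    where
      expand : sumR (suc B) (λ j → coeff P i j * (Y ^₁ j) k) ≈ coeff P i k
      expand with k ℕ.≤? B
      ... | yes k≤B = trans (sum-single (suc B) k _ (s≤s k≤B) (λ j _ j≢k → trans (*-congˡ (Y^-coeff-other j k j≢k)) (zeroʳ _)))
                            (trans (*-congˡ (Y^-coeff-same k)) (*-identityʳ _))
      ... | no  k≰B = trans (sum-zero (suc B) (λ j j<1+B →
                               trans (*-congˡ (Y^-coeff-other j k (λ { Eq.refl → k≰B (ℕP.≤-pred j<1+B) }))) (zeroʳ _)))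
                            (sym (degY i k (ℕP.≰⇒> k≰B)))

  brylawskiClear≈clearedSubst : ∀ B P → DegY≤ B P → brylawskiClear (coeff P) B ≈₁ clearedSubst B P
  brylawskiClear≈clearedSubst B P degY m = sym (trans (sum₁-coeff (suc B) _ m) (sum-cong (suc B) per-row))
    where
      per-row : ∀ i → (row P i *₁ weight B i) m ≈ sumR (suc B) (λ j → coeff P i j * (monoY (i ℕ.+ j) *₁ (ym1 ^₁ (B ∸ i))) m)
      per-row i =
        trans (*₁-congʳ (weight B i) (row-expansion B P i degY) m)
        (trans (Sums₁.*-distribʳ-sum (suc B) (weight B i) (λ j → C (coeff P i j) *₁ (Y ^₁ j)) m)
        (trans (sum₁-coeff (suc B) _ m)
               (sum-cong (suc B) (λ j → trans (per-term j m) (C*-coeff (coeff P i j) (monoY (i ℕ.+ j) *₁ Z) m)))))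
        where
          Z : Coeffs1
          Z = ym1 ^₁ (B ∸ i)
          per-term : ∀ j → (C (coeff P i j) *₁ (Y ^₁ j)) *₁ weight B i ≈₁ C (coeff P i j) *₁ (monoY (i ℕ.+ j) *₁ Z)
          per-term j = Poly.trans (*₁-assoc (C (coeff P i j)) (Y ^₁ j) (weight B i))
            (*₁-congˡ (C (coeff P i j)) (Poly.trans (Poly.sym (*₁-assoc (Y ^₁ j) (Y ^₁ i) Z))
              (*₁-congʳ Z (Poly.trans (Poly.sym (^₁-+ Y j i))
                (Poly.trans (Poly.reflexive (Eq.cong (Y ^₁_) (ℕP.+-comm j i))) (Poly.sym (monoY≈Y^ (i ℕ.+ j))))))))

  DegY≤⇒DegX≤-transpose : ∀ {β} P → DegY≤ β P → DegX≤ β (transpose P)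
  DegY≤⇒DegX≤-transpose P degY i β<i j = degY j i β<i

  DegX≤-transpose⇒DegY≤ : ∀ {β} P → DegX≤ β (transpose P) → DegY≤ β P
  DegX≤-transpose⇒DegY≤ P degX i j β<j = degX j β<j i

  evalX1 : ℕ → Poly2 → Coeffs1
  evalX1 N P = Over.sumR A[y] N (row P)

  evalX1-* : ∀ T U V αU αV N → IsProduct T U V → DegX≤ αU U → DegX≤ αV V → αU ℕ.+ αV < N →
             evalX1 N T ≈₁ evalX1 (suc αU) U *₁ evalX1 (suc αV) V
  evalX1-* T U V αU αV N T≈UV degU degV αU+αV<N =
    Poly.trans (Sums₁.sum-cong N (IsProduct⇒row-* T U V T≈UV)) (X.sum-*₁ N degU degV αU+αV<N)

  row-*-constantX : ∀ T U V → IsProduct T U V → DegX≤ 0 V → ∀ i → row T i ≈₁ row U i *₁ row V 0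
  row-*-constantX T U V T≈UV degV i = begin
    row T i                          ≈⟨ IsProduct⇒row-* T V U (IsProduct-comm T U V T≈UV) i ⟩
    (row V *ₓ row U) i               ≈⟨ XC.*₁-congʳ (row U) V≈C i ⟩
    (X.C (row V 0) *ₓ row U) i       ≈⟨ X.C*-coeff (row V 0) (row U) i ⟩
    row V 0 *₁ row U i               ≈⟨ *₁-comm (row V 0) (row U i) ⟩
    row U i *₁ row V 0               ∎
    where
      open ≈₁-Reasoning
      V≈C : row V ≈ₓ X.C (row V 0)
      V≈C zero    = Poly.refl
      V≈C (suc i) = degV (suc i) (s≤s z≤n)

  VanishesAtX1-if-factor : ∀ T U V αU αV N → IsProduct T U V → DegX≤ αU U → DegX≤ αV V → αU ℕ.+ αV < N →
                           evalX1 (suc αV) V ≈₁ 0₁ → VanishesAtX1 N T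
  VanishesAtX1-if-factor T U V αU αV N T≈UV degU degV αU+αV<N V1≈0 j = begin
    sumR N (λ i → coeff T i j)                     ≈⟨ sym (sum₁-coeff N (row T) j) ⟩
    evalX1 N T j                                   ≈⟨ evalX1-* T U V αU αV N T≈UV degU degV αU+αV<N j ⟩
    (evalX1 (suc αU) U *₁ evalX1 (suc αV) V) j     ≈⟨ *₁-zeroʳ (evalX1 (suc αU) U) (evalX1 (suc αV) V) V1≈0 j ⟩
    0#                                             ∎
    where open Relation.Binary.Reasoning.Setoid setoid

  VanishesAtY1-if-factor : ∀ T U V βU βV N → IsProduct T U V → DegY≤ βU U → DegY≤ βV V → DegX≤ 0 V →
                           βU ℕ.+ βV < N → sumR (suc βV) (row V 0) ≈ 0# → VanishesAtY1 N T
  VanishesAtY1-if-factor T U V βU βV N T≈UV degU degV degX βU+βV<N V₀1≈0 i = begin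
    sumR N (row T i)                                  ≈⟨ sum-cong N (row-*-constantX T U V T≈UV degX i) ⟩
    sumR N (row U i *₁ row V 0)                       ≈⟨ sum-*₁ N (degU i) (degV 0) βU+βV<N ⟩
    sumR (suc βU) (row U i) * sumR (suc βV) (row V 0) ≈⟨ *-congˡ V₀1≈0 ⟩
    sumR (suc βU) (row U i) * 0#                      ≈⟨ zeroʳ _ ⟩
    0#                                                ∎
    where open Relation.Binary.Reasoning.Setoid setoid

module BivariateDomain {a ℓa : Level} (A : CommutativeRing a ℓa) (dom : Over.IsIntegralDomain A) where
  open CommutativeRing A hiding (zero)
  open Over A
  open Bivariate A
  open UnivariateDomain A dom using (*₁-noZeroDivisors)

  DegX≤-split : ∀ T U V a → IsProduct T U V → DegX≤ a T → ¬ IsZero₂ U → ¬ IsZero₂ V →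
                Σ ℕ λ αU → Σ ℕ λ αV → DegX≤ αU U × DegX≤ αV V × αU ℕ.+ αV ≤ a
  DegX≤-split T U V a T≈UV degT U≉0 V≉0 = shrink (bound U) (bound V) (DegX≤-bound U) (DegX≤-bound V)
    where
      shrink : ∀ αU αV → DegX≤ αU U → DegX≤ αV V →
               Σ ℕ λ αU → Σ ℕ λ αV → DegX≤ αU U × DegX≤ αV V × αU ℕ.+ αV ≤ a
      shrink αU αV degU degV with αU ℕ.+ αV ℕ.≤? a
      ... | yes αU+αV≤a = αU , αV , degU , degV , αU+αV≤a
      ... | no  αU+αV≰a
        with *₁-noZeroDivisors (bound U) (bound V) (row U αU) (row V αV) (DegY≤-bound U αU) (DegY≤-bound V αV)
               (λ j → trans (sym (top-row T U V T≈UV degU degV j)) (degT _ (ℕP.≰⇒> αU+αV≰a) j))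
      shrink zero      αV degU degV | no _ | inj₁ U₀≈0 = contradiction (λ i j → X.Deg≤0-zero degU U₀≈0 i j) U≉0
      shrink (suc αU)  αV degU degV | no _ | inj₁ Uₜ≈0 = shrink αU αV (X.Deg≤-pred degU Uₜ≈0) degV
      shrink αU zero      degU degV | no _ | inj₂ V₀≈0 = contradiction (λ i j → X.Deg≤0-zero degV V₀≈0 i j) V≉0
      shrink αU (suc αV)  degU degV | no _ | inj₂ Vₜ≈0 = shrink αU αV degU (X.Deg≤-pred degV Vₜ≈0)

  DegY≤-split : ∀ T U V b → IsProduct T U V → DegY≤ b T → ¬ IsZero₂ U → ¬ IsZero₂ V →
                Σ ℕ λ βU → Σ ℕ λ βV → DegY≤ βU U × DegY≤ βV V × βU ℕ.+ βV ≤ b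
  DegY≤-split T U V b T≈UV degT U≉0 V≉0 =
    let (βU , βV , degU , degV , βU+βV≤b) =
          DegX≤-split (transpose T) (transpose U) (transpose V) b (IsProduct-transpose T U V T≈UV)
            (DegY≤⇒DegX≤-transpose T degT) (λ U'≈0 → U≉0 (λ i j → U'≈0 j i)) (λ V'≈0 → V≉0 (λ i j → V'≈0 j i))
    in βU , βV , DegX≤-transpose⇒DegY≤ U degU , DegX≤-transpose⇒DegY≤ V degV , βU+βV≤b

module Divisibility {a ℓa : Level} (A : CommutativeRing a ℓa) where
  open CommutativeRing A hiding (zero)
  open Over A
  open Sums A
  open Convolution A
  open Univariate A using (ym1-quotient; ym1-quotient-spec; Deg≤-ym1-quotient)
  open Bivariate A
  open import Algebra.Properties.Ring ring using (-0#≈0#)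
  private
    module XC = Convolution A[y]

  VanishesAtX1⇒xm1∣ : ∀ T → VanishesAtX1 (suc (bound T)) T → Divides2 xm1 T
  VanishesAtX1⇒xm1∣ T T1≈0 = Q , row-*⇒IsProduct T xm1 Q (λ i →
    Poly.trans (X.ym1-quotient-spec (row T) i) (XC.*₁-congʳ (row Q) (λ i j → sym (xm1≈x-1 i j)) i))
    where
      B : ℕ
      B = bound T
      T1≈0₁ : Over.sumR A[y] (suc B) (row T) ≈₁ 0₁
      T1≈0₁ j = trans (sum₁-coeff (suc B) (row T) j) (T1≈0 j)
      Q-bounded : BoundedBy B (λ i j → X.ym1-quotient (row T) i j)
      Q-bounded i j (inj₁ B<i) = X.Deg≤-ym1-quotient B (row T) (DegX≤-bound T) T1≈0₁ i B<i j
      Q-bounded i j (inj₂ B<j) =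
        trans (-‿cong (trans (sum₁-coeff (suc i) (row T) j) (sum-zero (suc i) (λ k _ → DegY≤-bound T k j B<j)))) -0#≈0#
      Q : Poly2
      Q = record { coeff = λ i j → X.ym1-quotient (row T) i j ; bound = B ; bounded = Q-bounded }
      xm1≈x-1 : ∀ i j → coeff xm1 i j ≈ Over.ym1 A[y] i j
      xm1≈x-1 zero          zero    = refl
      xm1≈x-1 zero          (suc j) = sym -0#≈0#
      xm1≈x-1 (suc zero)    zero    = refl
      xm1≈x-1 (suc zero)    (suc j) = refl
      xm1≈x-1 (suc (suc i)) j       = refl

  VanishesAtY1⇒ym1₂∣ : ∀ T → VanishesAtY1 (suc (bound T)) T → Divides2 ym1₂ T
  VanishesAtY1⇒ym1₂∣ T T1≈0 = Q , row-*⇒IsProduct T ym1₂ Q (λ i →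
    Poly.trans (ym1-quotient-spec (row T i))
    (Poly.trans (Poly.sym (X.C*-coeff ym1 (row Q) i)) (XC.*₁-congʳ (row Q) ym1₂≈y-1 i)))
    where
      B : ℕ
      B = bound T
      Q-bounded : BoundedBy B (λ i j → ym1-quotient (row T i) j)
      Q-bounded i j (inj₁ B<i) = trans (-‿cong (sum-zero (suc j) (λ k _ → DegX≤-bound T i B<i k))) -0#≈0#
      Q-bounded i j (inj₂ B<j) = Deg≤-ym1-quotient B (row T i) (DegY≤-bound T i) (T1≈0 i) j B<j
      Q : Poly2
      Q = record { coeff = λ i j → ym1-quotient (row T i) j ; bound = B ; bounded = Q-bounded }
      ym1₂≈y-1 : X.C ym1 ≈ₓ row ym1₂
      ym1₂≈y-1 zero    zero          = refl
      ym1₂≈y-1 zero    (suc zero)    = refl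
      ym1₂≈y-1 zero    (suc (suc j)) = refl
      ym1₂≈y-1 (suc i) j             = refl

module Brylawski {a ℓa : Level} (A : CommutativeRing a ℓa) (dom : Over.IsIntegralDomain A) where
  open CommutativeRing A hiding (zero)
  open Over A
  open Convolution A
  open Univariate A
  open UnivariateDomain A dom
  open Bivariate A
  open BivariateDomain A dom
  open Divisibility A
  open import Algebra.Properties.CommutativeSemigroup Poly.*-commutativeSemigroup using (x∙yz≈y∙xz)
  open import Algebra.Properties.Ring ring using (-‿injective; +-cancelˡ)
  private
    module ≈-Reasoning = Relation.Binary.Reasoning.Setoid setoid
    module ≈₁-Reasoning = Relation.Binary.Reasoning.Setoid Poly.setoid

  -- IsBrylawski n r c T unfolds to c ≉ 0 × IsBrylawskiAt n r c T (bound T)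
  IsBrylawskiAt : ℕ → ℕ → Carrier → Poly2 → ℕ → Set ℓa
  IsBrylawskiAt n r c T B =
    ∀ m → ((ym1 ^₁ r) *₁ brylawskiClear (coeff T) B) m ≈ scale₁ c (monoY n *₁ (ym1 ^₁ B)) m

  ClearedBrylawski : ℕ → ℕ → Carrier → Poly2 → ℕ → Set ℓa
  ClearedBrylawski n r c T α = (ym1 ^₁ r) *₁ clearedSubst α T ≈₁ scaledPow c n α

  IsBrylawskiAt⇒ClearedBrylawski : ∀ n r c T B → DegY≤ B T → IsBrylawskiAt n r c T B → ClearedBrylawski n r c T B
  IsBrylawskiAt⇒ClearedBrylawski n r c T B degY brylawski m = begin
    ((ym1 ^₁ r) *₁ clearedSubst B T) m
      ≈⟨ *₁-congˡ (ym1 ^₁ r) (Poly.sym (brylawskiClear≈clearedSubst B T degY)) m ⟩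
    ((ym1 ^₁ r) *₁ brylawskiClear (coeff T) B) m       ≈⟨ brylawski m ⟩
    c * (monoY n *₁ (ym1 ^₁ B)) m                       ≈⟨ sym (C*-coeff c (monoY n *₁ (ym1 ^₁ B)) m) ⟩
    (C c *₁ (monoY n *₁ (ym1 ^₁ B))) m                  ≈⟨ *₁-congˡ (C c) (*₁-congʳ (ym1 ^₁ B) (monoY≈Y^ n)) m ⟩
    scaledPow c n B m                                   ∎
    where open ≈-Reasoning

  ClearedBrylawski-lower : ∀ n r c T {α β} → DegX≤ α T → α ≤ β →
                           ClearedBrylawski n r c T β → ClearedBrylawski n r c T α
  ClearedBrylawski-lower n r c T {α} {β} degX α≤β brylawski = ym1^-cancel d _ _ (begin
    (ym1 ^₁ d) *₁ ((ym1 ^₁ r) *₁ clearedSubst α T)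
      ≈⟨ x∙yz≈y∙xz (ym1 ^₁ d) (ym1 ^₁ r) (clearedSubst α T) ⟩
    (ym1 ^₁ r) *₁ ((ym1 ^₁ d) *₁ clearedSubst α T)
      ≈⟨ *₁-congˡ (ym1 ^₁ r) (Poly.sym (clearedSubst-+ α d T degX)) ⟩
    (ym1 ^₁ r) *₁ clearedSubst (α ℕ.+ d) T
      ≈⟨ Poly.reflexive (Eq.cong (λ k → (ym1 ^₁ r) *₁ clearedSubst k T) α+d≡β) ⟩
    (ym1 ^₁ r) *₁ clearedSubst β T
      ≈⟨ brylawski ⟩
    scaledPow c n β
      ≈⟨ Poly.reflexive (Eq.cong (scaledPow c n) (Eq.trans (Eq.sym α+d≡β) (ℕP.+-comm α d))) ⟩
    scaledPow c n (d ℕ.+ α)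
      ≈⟨ scaledPow-ym1^ c n d α ⟩
    (ym1 ^₁ d) *₁ scaledPow c n α ∎)
    where
      open ≈₁-Reasoning
      d : ℕ
      d = β ∸ α
      α+d≡β : α ℕ.+ d ≡ β
      α+d≡β = ℕP.m+[n∸m]≡n α≤β

  -- evaluating at y = 1 kills the left-hand side unless r ≤ α
  ClearedBrylawski⇒r≤α : ∀ n r c T α {b} → c ≉ 0# → DegY≤ b T → ClearedBrylawski n r c T α → r ≤ α
  ClearedBrylawski⇒r≤α n r c T α {b} c≉0 degY brylawski with r ℕ.≤? α
  ... | yes r≤α = r≤α
  ... | no  r≰α = contradiction c≈0 c≉0
    where
      k : ℕ
      k = r ∸ suc α
      α+1+k≡r : α ℕ.+ suc k ≡ r
      α+1+k≡r = Eq.trans (ℕP.+-suc α k) (ℕP.m+[n∸m]≡n (ℕP.≰⇒> r≰α))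
      reduced : (ym1 ^₁ suc k) *₁ clearedSubst α T ≈₁ scaledPow c n 0
      reduced = ym1^-cancel α _ _ (begin
        (ym1 ^₁ α) *₁ ((ym1 ^₁ suc k) *₁ clearedSubst α T)
          ≈⟨ Poly.sym (*₁-assoc (ym1 ^₁ α) (ym1 ^₁ suc k) (clearedSubst α T)) ⟩
        ((ym1 ^₁ α) *₁ (ym1 ^₁ suc k)) *₁ clearedSubst α T
          ≈⟨ *₁-congʳ (clearedSubst α T) (Poly.sym (^₁-+ ym1 α (suc k))) ⟩
        (ym1 ^₁ (α ℕ.+ suc k)) *₁ clearedSubst α T
          ≈⟨ Poly.reflexive (Eq.cong (λ e → (ym1 ^₁ e) *₁ clearedSubst α T) α+1+k≡r) ⟩
        (ym1 ^₁ r) *₁ clearedSubst α T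
          ≈⟨ brylawski ⟩
        scaledPow c n α
          ≈⟨ Poly.reflexive (Eq.cong (scaledPow c n) (Eq.sym (ℕP.+-identityʳ α))) ⟩
        scaledPow c n (α ℕ.+ 0)
          ≈⟨ scaledPow-ym1^ c n α 0 ⟩
        (ym1 ^₁ α) *₁ scaledPow c n 0 ∎)
        where open ≈₁-Reasoning
      N : ℕ
      N = suc (suc k ℕ.+ (α ℕ.+ b) ℕ.+ n)
      c≈0 : c ≈ 0#
      c≈0 = begin
        c                                               ≈⟨ sym (sum-scaledPow-zeroʳ c n N (s≤s (ℕP.m≤n+m n _))) ⟩
        sumR N (scaledPow c n 0)                        ≈⟨ Sums.sum-cong A N (Poly.sym reduced) ⟩
        sumR N ((ym1 ^₁ suc k) *₁ clearedSubst α T)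
          ≈⟨ sum-ym1^suc-* k N (Deg≤-clearedSubst α b T degY) (s≤s (ℕP.m≤m+n _ n)) ⟩
        0#                                              ∎
        where open ≈-Reasoning

  ClearedBrylawski⇒clearedSubst≈ : ∀ n r c T α → r ≤ α → ClearedBrylawski n r c T α →
                                   clearedSubst α T ≈₁ scaledPow c n (α ∸ r)
  ClearedBrylawski⇒clearedSubst≈ n r c T α r≤α brylawski = ym1^-cancel r _ _
    (Poly.trans brylawski (Poly.trans (Poly.reflexive (Eq.cong (scaledPow c n) (Eq.sym (ℕP.m+[n∸m]≡n r≤α))))
                                      (scaledPow-ym1^ c n r (α ∸ r))))

  ClearedBrylawski⇒constantTerm≈0 : ∀ n r c T α → 1 ≤ n → ClearedBrylawski n r c T α → coeff T 0 0 ≈ 0#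
  ClearedBrylawski⇒constantTerm≈0 n r c T α 1≤n brylawski
    with x*y≈0⇒x≈0∨y≈0 _ _ lhs≈0
    where
      open ≈-Reasoning
      lhs≈0 : (ym1 ^₁ r) 0 * (coeff T 0 0 * (ym1 ^₁ α) 0) ≈ 0#
      lhs≈0 = begin
        (ym1 ^₁ r) 0 * (coeff T 0 0 * (ym1 ^₁ α) 0) ≈⟨ *-congˡ (sym (clearedSubst-at0 α T)) ⟩
        (ym1 ^₁ r) 0 * clearedSubst α T 0           ≈⟨ sym (*₁-at0 (ym1 ^₁ r) (clearedSubst α T)) ⟩
        ((ym1 ^₁ r) *₁ clearedSubst α T) 0          ≈⟨ brylawski 0 ⟩
        scaledPow c n α 0                           ≈⟨ C*-coeff c ((Y ^₁ n) *₁ (ym1 ^₁ α)) 0 ⟩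
        c * ((Y ^₁ n) *₁ (ym1 ^₁ α)) 0
          ≈⟨ *-congˡ (trans (*₁-at0 (Y ^₁ n) (ym1 ^₁ α)) (*-congʳ (Y^-coeff-other n 0 (ℕP.m<n⇒n≢0 1≤n)))) ⟩
        c * (0# * (ym1 ^₁ α) 0)                     ≈⟨ trans (*-congˡ (zeroˡ _)) (zeroʳ c) ⟩
        0#                                          ∎
  ... | inj₁ ym1^r≈0 = contradiction ym1^r≈0 (ym1^-at0≉0 r)
  ... | inj₂ tα≈0 with x*y≈0⇒x≈0∨y≈0 _ _ tα≈0
  ...   | inj₁ t00≈0    = t00≈0
  ...   | inj₂ ym1^α≈0 = contradiction ym1^α≈0 (ym1^-at0≉0 α)

  clearedSubst₁-coeff : ∀ V → DegY≤ 0 V → ∀ i → clearedSubst 1 V i ≈ coeff V 0 0 * ym1 i + coeff V 1 0 * Y i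
  clearedSubst₁-coeff V degY i =
    trans (sum₁-coeff 2 (λ p → row V p *₁ weight 1 p) i) (trans (+-congʳ (+-identityˡ _)) (+-cong
      (trans (Poly.trans (*₁-congʳ (weight 1 0) (row≈C V degY 0)) (*₁-congˡ (C (coeff V 0 0)) weight₁₀≈ym1) i)
             (C*-coeff (coeff V 0 0) ym1 i))
      (trans (Poly.trans (*₁-congʳ (weight 1 1) (row≈C V degY 1)) (*₁-congˡ (C (coeff V 1 0)) weight₁₁≈Y) i)
             (C*-coeff (coeff V 1 0) Y i))))
    where
      weight₁₀≈ym1 : weight 1 0 ≈₁ ym1
      weight₁₀≈ym1 = Poly.trans (*₁-identityˡ (ym1 ^₁ 1)) (Poly.*-identityʳ ym1)
      weight₁₁≈Y : weight 1 1 ≈₁ Y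
      weight₁₁≈Y = Poly.trans (Poly.*-identityʳ (Y ^₁ 1)) (Poly.*-identityʳ Y)

  clearedSubst₁-at0 : ∀ V → DegY≤ 0 V → clearedSubst 1 V 0 ≈ - coeff V 0 0
  clearedSubst₁-at0 V degY =
    trans (clearedSubst₁-coeff V degY 0) (trans (+-congˡ (zeroʳ _)) (trans (+-identityʳ _) (x*ym1₀≈-x _)))

  clearedSubst₁-at1 : ∀ V → DegY≤ 0 V → clearedSubst 1 V 1 ≈ coeff V 0 0 + coeff V 1 0
  clearedSubst₁-at1 V degY = trans (clearedSubst₁-coeff V degY 1) (+-cong (*-identityʳ _) (*-identityʳ _))

  -- V = v₀₀ + v₁₀x has cleared substitution v₀₀(y-1) + v₁₀y, which is e or e(y-1):
  -- in the first case V(1,y) = 0, in the second v₁₀ = 0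
  linear-in-x-constant : ∀ T U V αU e k N → IsProduct T U V → ¬ VanishesAtX1 N T → DegX≤ αU U → αU ℕ.+ 1 < N →
                         DegX≤ 1 V → DegY≤ 0 V → k ≤ 1 → clearedSubst 1 V ≈₁ C e *₁ (ym1 ^₁ k) → IsConstant V
  linear-in-x-constant T U V αU e zero N T≈UV T≢0atX1 degU αU+1<N degX degY _ QV≈ =
    contradiction (VanishesAtX1-if-factor T U V αU 1 N T≈UV degU degX αU+1<N V-vanishes) T≢0atX1
    where
      V-vanishes : evalX1 2 V ≈₁ 0₁
      V-vanishes zero    = trans (sum₁-coeff 2 (row V) 0) (trans (+-congʳ (+-identityˡ _))
        (trans (sym (clearedSubst₁-at1 V degY)) (trans (QV≈ 1) (trans (C*-coeff e one₁ 1) (zeroʳ e)))))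
      V-vanishes (suc j) = trans (sum₁-coeff 2 (row V) (suc j)) (Sums.sum-zero A 2 (λ i _ → degY i (suc j) (s≤s z≤n)))
  linear-in-x-constant T U V αU e (suc zero) N T≈UV T≢0atX1 degU αU+1<N degX degY _ QV≈ = V-constant
    where
      v₀₀≈e : coeff V 0 0 ≈ e
      v₀₀≈e = -‿injective (trans (sym (clearedSubst₁-at0 V degY))
                                 (trans (QV≈ 0) (trans (C*ym1^1-coeff e 0) (x*ym1₀≈-x e))))
      v₁₀≈0 : coeff V 1 0 ≈ 0#
      v₁₀≈0 = +-cancelˡ (coeff V 0 0) (coeff V 1 0) 0# (begin
        coeff V 0 0 + coeff V 1 0   ≈⟨ sym (clearedSubst₁-at1 V degY) ⟩
        clearedSubst 1 V 1          ≈⟨ QV≈ 1 ⟩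
        (C e *₁ (ym1 ^₁ 1)) 1       ≈⟨ trans (C*ym1^1-coeff e 1) (*-identityʳ e) ⟩
        e                           ≈⟨ trans (sym v₀₀≈e) (sym (+-identityʳ _)) ⟩
        coeff V 0 0 + 0#            ∎)
        where open ≈-Reasoning
      V-constant : IsConstant V
      V-constant zero          (suc j) _ = degY 0 (suc j) (s≤s z≤n)
      V-constant (suc zero)    zero    _ = v₁₀≈0
      V-constant (suc zero)    (suc j) _ = degY 1 (suc j) (s≤s z≤n)
      V-constant (suc (suc i)) j       _ = degX (suc (suc i)) (s≤s (s≤s z≤n)) j
  linear-in-x-constant T U V αU e (suc (suc k)) N _ _ _ _ _ _ (s≤s ()) _

  clearedSubst₀≈row₀ : ∀ V → clearedSubst 0 V ≈₁ row V 0
  clearedSubst₀≈row₀ V =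
    Poly.trans (Poly.+-identityˡ _) (Poly.trans (*₁-congˡ (row V 0) (*₁-identityˡ one₁)) (Poly.*-identityʳ (row V 0)))

  -- V = v₀₀ + v₀₁y is its own cleared substitution, which is e or e(y-1):
  -- in the first case v₀₁ = 0, in the second V(x,1) = 0
  linear-in-y-constant : ∀ T U V βU e k N → IsProduct T U V → ¬ VanishesAtY1 N T → DegY≤ βU U → βU ℕ.+ 1 < N →
                         DegX≤ 0 V → DegY≤ 1 V → k ≤ 1 → clearedSubst 0 V ≈₁ C e *₁ (ym1 ^₁ k) → IsConstant V
  linear-in-y-constant T U V βU e zero N T≈UV T≢0atY1 degU βU+1<N degX degY _ QV≈ = V-constant
    where
      v₀₁≈0 : coeff V 0 1 ≈ 0#
      v₀₁≈0 = trans (sym (clearedSubst₀≈row₀ V 1)) (trans (QV≈ 1) (trans (C*-coeff e one₁ 1) (zeroʳ e)))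
      V-constant : IsConstant V
      V-constant zero    (suc zero)    _ = v₀₁≈0
      V-constant zero    (suc (suc j)) _ = degY 0 (suc (suc j)) (s≤s (s≤s z≤n))
      V-constant (suc i) j             _ = degX (suc i) (s≤s z≤n) j
  linear-in-y-constant T U V βU e (suc zero) N T≈UV T≢0atY1 degU βU+1<N degX degY _ QV≈ =
    contradiction (VanishesAtY1-if-factor T U V βU 1 N T≈UV degU degY degX βU+1<N V₀-at1) T≢0atY1
    where
      V₀≈e[y-1] : ∀ j → coeff V 0 j ≈ e * ym1 j
      V₀≈e[y-1] j = trans (sym (clearedSubst₀≈row₀ V j)) (trans (QV≈ j) (C*ym1^1-coeff e j))
      V₀-at1 : sumR 2 (row V 0) ≈ 0#
      V₀-at1 = begin
        (0# + coeff V 0 0) + coeff V 0 1   ≈⟨ +-cong (+-congˡ (V₀≈e[y-1] 0)) (V₀≈e[y-1] 1) ⟩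
        (0# + e * ym1 0) + e * ym1 1       ≈⟨ +-cong (trans (+-identityˡ _) (x*ym1₀≈-x e)) (*-identityʳ e) ⟩
        - e + e                            ≈⟨ -‿inverseˡ e ⟩
        0#                                 ∎
        where open ≈-Reasoning
  linear-in-y-constant T U V βU e (suc (suc k)) N _ _ _ _ _ _ (s≤s ()) _

  ym1-exponent≤1 : ∀ V {αV βV} e k → DegY≤ βV V → αV ℕ.+ βV ≤ 1 →
                   clearedSubst αV V ≈₁ C e *₁ (ym1 ^₁ k) → clearedSubst αV V 0 ≉ 0# → k ≤ 1
  ym1-exponent≤1 V {αV} {βV} e k degY αV+βV≤1 QV≈ QV₀≉0 =
    C*ym1^-degree e k (Deg≤-cong QV≈ (Deg≤-mono αV+βV≤1 (Deg≤-clearedSubst αV βV V degY))) (QV₀≉0 ∘ trans (QV≈ 0))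

  small-factor-constant : ∀ T U V {αU αV βU βV} e k N → IsProduct T U V → ¬ VanishesAtX1 N T → ¬ VanishesAtY1 N T →
    DegX≤ αU U → DegY≤ βU U → DegX≤ αV V → DegY≤ βV V → αU ℕ.+ αV < N → βU ℕ.+ βV < N →
    αV ℕ.+ βV ≤ 1 → clearedSubst αV V ≈₁ C e *₁ (ym1 ^₁ k) → clearedSubst αV V 0 ≉ 0# → IsConstant V
  small-factor-constant T U V {αU} {zero} {βU} {zero} e k N _ _ _ _ _ degXV degYV _ _ _ _ _ =
    constant-if-DegX≤0-DegY≤0 V degXV degYV
  small-factor-constant T U V {αU} {suc zero} {βU} {zero} e k N T≈UV T≢0atX1 _ degXU _ degXV degYV α<N _ s≤1 QV≈ QV₀≉0 =
    linear-in-x-constant T U V αU e k N T≈UV T≢0atX1 degXU α<N degXV degYV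
      (ym1-exponent≤1 V e k degYV s≤1 QV≈ QV₀≉0) QV≈
  small-factor-constant T U V {αU} {zero} {βU} {suc zero} e k N T≈UV _ T≢0atY1 _ degYU degXV degYV _ β<N s≤1 QV≈ QV₀≉0 =
    linear-in-y-constant T U V βU e k N T≈UV T≢0atY1 degYU β<N degXV degYV
      (ym1-exponent≤1 V e k degYV s≤1 QV≈ QV₀≉0) QV≈
  small-factor-constant T U V {αV = suc zero}    {βV = suc _}       e k N _ _ _ _ _ _ _ _ _ (s≤s ()) _ _
  small-factor-constant T U V {αV = suc (suc _)}                    e k N _ _ _ _ _ _ _ _ _ (s≤s ()) _ _
  small-factor-constant T U V {αV = zero}        {βV = suc (suc _)} e k N _ _ _ _ _ _ _ _ _ (s≤s ()) _ _

  record BrylawskiHypotheses (T : Poly2) : Set (a ⊔ ℓa) where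
    field
      n r B dx dy  : ℕ
      c            : Carrier
      1≤n          : 1 ≤ n
      c≉0          : c ≉ 0#
      boundX       : DegX≤ B T
      boundY       : DegY≤ B T
      brylawski    : IsBrylawskiAt n r c T B
      T≢0atX1      : ¬ VanishesAtX1 (suc B) T
      T≢0atY1      : ¬ VanishesAtY1 (suc B) T
      t₁₀≉0        : coeff T 1 0 ≉ 0#
      degX         : DegX≤ dx T
      degY         : DegY≤ dy T
      dx+dy≤1+n    : dx ℕ.+ dy ≤ suc n

  BrylawskiHypotheses-intro : ∀ n r c T → r < n → IsBrylawski n r c T →
    ¬ Divides2 xm1 T → ¬ Divides2 ym1₂ T → coeff T 1 0 ≉ 0# →
    (Σ ℕ λ dx → Σ ℕ λ dy → DegX T dx × DegY T dy × (dx ℕ.+ dy ≡ n ⊎ dx ℕ.+ dy ≡ suc n)) →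
    BrylawskiHypotheses T
  BrylawskiHypotheses-intro n r c T r<n (c≉0 , brylawski) ¬xm1∣T ¬ym1₂∣T t₁₀≉0
                            (dx , dy , (_ , degX) , (_ , degY) , dx+dy≡) =
    record
      { n = n ; r = r ; B = bound T ; dx = dx ; dy = dy ; c = c
      ; 1≤n = ℕP.≤-trans (s≤s z≤n) r<n
      ; c≉0 = c≉0
      ; boundX = DegX≤-bound T
      ; boundY = DegY≤-bound T
      ; brylawski = brylawski
      ; T≢0atX1 = ¬xm1∣T ∘ VanishesAtX1⇒xm1∣ T
      ; T≢0atY1 = ¬ym1₂∣T ∘ VanishesAtY1⇒ym1₂∣ T
      ; t₁₀≉0 = t₁₀≉0
      ; degX = λ i dx<i j → degX i j dx<i
      ; degY = degY
      ; dx+dy≤1+n = [ (λ dx+dy≡n → ℕP.≤-trans (ℕP.≤-reflexive dx+dy≡n) (ℕP.n≤1+n n)) , ℕP.≤-reflexive ] dx+dy≡ }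

  module BrylawskiFactors {T : Poly2} (hyp : BrylawskiHypotheses T) where
    open BrylawskiHypotheses hyp

    clearedBrylawski : ClearedBrylawski n r c T B
    clearedBrylawski = IsBrylawskiAt⇒ClearedBrylawski n r c T B boundY brylawski

    cleared-factorization : ∀ U V αU αV → IsProduct T U V → DegX≤ αU U → DegX≤ αV V → αU ℕ.+ αV ≤ B →
                            clearedSubst αV V *₁ clearedSubst αU U ≈₁ scaledPow c n (αU ℕ.+ αV ∸ r)
    cleared-factorization U V αU αV T≈UV degU degV α≤B =
      Poly.trans (*₁-comm (clearedSubst αV V) (clearedSubst αU U))
      (Poly.trans (Poly.sym (clearedSubst-* T U V αU αV T≈UV degU degV))
                  (ClearedBrylawski⇒clearedSubst≈ n r c T α r≤α brylawskiα))
      where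
        α : ℕ
        α = αU ℕ.+ αV
        brylawskiα : ClearedBrylawski n r c T α
        brylawskiα = ClearedBrylawski-lower n r c T (DegX≤-* T U V T≈UV degU degV) α≤B clearedBrylawski
        r≤α : r ≤ α
        r≤α = ClearedBrylawski⇒r≤α n r c T α c≉0 boundY brylawskiα

    -- comparing degrees in c·yⁿ(y-1)^m = clearedSubst αU U · e(y-1)^k forces αV + βV ≤ 1
    factor-shape : ∀ U V {αU αV βU βV} → IsProduct T U V → DegX≤ αU U → DegX≤ αV V → DegY≤ βU U → DegY≤ βV V →
                   αU ℕ.+ αV ≤ dx → αU ℕ.+ αV ≤ B → βU ℕ.+ βV ≤ dy → coeff V 0 0 ≉ 0# →
                   Σ Carrier λ e → Σ ℕ λ k →
                     αV ℕ.+ βV ≤ 1 × clearedSubst αV V ≈₁ C e *₁ (ym1 ^₁ k) × clearedSubst αV V 0 ≉ 0#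
    factor-shape U V {αU} {αV} {βU} {βV} T≈UV degXU degXV degYU degYV α≤dx α≤B β≤dy v₀₀≉0 =
      let (k , e , k≤m , QV≈) = divisor-of-scaledPow n m c QV QU (αV ℕ.+ βV) (αU ℕ.+ βU) degQV degQU c≉0 QV₀≉0 QV*QU≈
          n+m≤αU+βU+k = scaledPow-degree c n m degQU (Deg≤-* (Deg≤-C e) (Deg≤-^ ym1 k Deg≤-ym1)) c≉0
            (Poly.trans (*₁-congˡ QU (Poly.sym QV≈)) (Poly.trans (*₁-comm QU QV) QV*QU≈))
      in e , k , n+m≤s+k⇒t≤1 k≤m size≤1+n n+m≤αU+βU+k , QV≈ , QV₀≉0
      where
        m : ℕ
        m = αU ℕ.+ αV ∸ r
        QU QV : Coeffs1
        QU = clearedSubst αU U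
        QV = clearedSubst αV V
        degQU : Deg≤ (αU ℕ.+ βU) QU
        degQU = Deg≤-clearedSubst αU βU U degYU
        degQV : Deg≤ (αV ℕ.+ βV) QV
        degQV = Deg≤-clearedSubst αV βV V degYV
        QV*QU≈ : QV *₁ QU ≈₁ scaledPow c n m
        QV*QU≈ = cleared-factorization U V αU αV T≈UV degXU degXV α≤B
        QV₀≉0 : QV 0 ≉ 0#
        QV₀≉0 = x≉0∧y≉0⇒x*y≉0 v₀₀≉0 (ym1^-at0≉0 αV) ∘ trans (sym (clearedSubst-at0 αV V))
        size≤1+n : (αU ℕ.+ βU) ℕ.+ (αV ℕ.+ βV) ≤ suc n
        size≤1+n = ℕP.≤-trans (ℕP.≤-reflexive (+-interchange αU βU αV βV))
                              (ℕP.≤-trans (ℕP.+-mono-≤ α≤dx β≤dy) dx+dy≤1+n)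
          where open import Algebra.Properties.CommutativeSemigroup ℕP.+-commutativeSemigroup
                  using () renaming (interchange to +-interchange)

    factor-constant-if-u₀₀≈0 : ∀ U V → IsProduct T U V → coeff U 0 0 ≈ 0# → IsConstant V
    factor-constant-if-u₀₀≈0 U V T≈UV u₀₀≈0 =
      let (αU , αV , degXU , degXV , α≤dx⊓B) =
            DegX≤-split T U V (dx ℕ.⊓ B) T≈UV (DegX≤-⊓ dx B T degX boundX) U≉0 V≉0
          (βU , βV , degYU , degYV , β≤dy⊓B) =
            DegY≤-split T U V (dy ℕ.⊓ B) T≈UV (DegY≤-⊓ dy B T degY boundY) U≉0 V≉0
          α≤B = ℕP.≤-trans α≤dx⊓B (ℕP.m⊓n≤n dx B)
          (e , k , αV+βV≤1 , QV≈ , QV₀≉0) =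
            factor-shape U V T≈UV degXU degXV degYU degYV (ℕP.≤-trans α≤dx⊓B (ℕP.m⊓n≤m dx B)) α≤B
              (ℕP.≤-trans β≤dy⊓B (ℕP.m⊓n≤m dy B)) v₀₀≉0
      in small-factor-constant T U V e k (suc B) T≈UV T≢0atX1 T≢0atY1 degXU degYU degXV degYV
           (s≤s α≤B) (s≤s (ℕP.≤-trans β≤dy⊓B (ℕP.m⊓n≤n dy B))) αV+βV≤1 QV≈ QV₀≉0
      where
        U≉0 : ¬ IsZero₂ U
        U≉0 U≈0 = t₁₀≉0 (trans (T≈UV 1 0) (mulCoeff-zeroˡ U V U≈0 1 0))
        V≉0 : ¬ IsZero₂ V
        V≉0 V≈0 = t₁₀≉0 (trans (T≈UV 1 0) (mulCoeff-zeroʳ U V V≈0 1 0))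
        v₀₀≉0 : coeff V 0 0 ≉ 0#
        v₀₀≉0 v₀₀≈0 = t₁₀≉0 (begin
          coeff T 1 0                                                              ≈⟨ T≈UV 1 0 ⟩
          (0# + (0# + coeff U 0 0 * coeff V 1 0)) + (0# + coeff U 1 0 * coeff V 0 0) ≈⟨ +-cong
            (trans (+-identityˡ _) (trans (+-identityˡ _) (trans (*-congʳ u₀₀≈0) (zeroˡ _))))
            (trans (+-identityˡ _) (trans (*-congˡ v₀₀≈0) (zeroʳ _))) ⟩
          0# + 0#                                                                  ≈⟨ +-identityˡ 0# ⟩
          0#                                                                       ∎)
          where open ≈-Reasoning

    factor-constant : ∀ U V → IsProduct T U V → IsConstant U ⊎ IsConstant V
    factor-constant U V T≈UV with x*y≈0⇒x≈0∨y≈0 (coeff U 0 0) (coeff V 0 0) u₀₀v₀₀≈0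
      where
        u₀₀v₀₀≈0 : coeff U 0 0 * coeff V 0 0 ≈ 0#
        u₀₀v₀₀≈0 = trans (sym (trans (+-identityˡ _) (+-identityˡ _)))
          (trans (sym (T≈UV 0 0)) (ClearedBrylawski⇒constantTerm≈0 n r c T B 1≤n clearedBrylawski))
    ... | inj₁ u₀₀≈0 = inj₂ (factor-constant-if-u₀₀≈0 U V T≈UV u₀₀≈0)
    ... | inj₂ v₀₀≈0 = inj₁ (factor-constant-if-u₀₀≈0 V U (IsProduct-comm T U V T≈UV) v₀₀≈0)

module Irreducibility {a ℓa : Level} (A : CommutativeRing a ℓa) (dom : Over.IsIntegralDomain A) where
  open CommutativeRing A hiding (zero)
  open Over A
  open Sums A
  open Convolution A
  open Univariate A using (Deg≤; *₁-at0)
  open UnivariateDomain A dom using (Deg≤-factor)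
  open Bivariate A using (IsProduct-comm)

  mulCoeff-constantˡ : ∀ U W → IsConstant U → ∀ i j → mulCoeff U W i j ≈ coeff U 0 0 * coeff W i j
  mulCoeff-constantˡ U W U-const i j =
    trans (sum-single (suc i) 0 _ (s≤s z≤n) row-off) (sum-single (suc j) 0 _ (s≤s z≤n) column-off)
    where
      row-off : ∀ a → a < suc i → a ≢ 0 → sumR (suc j) (λ b → coeff U a b * coeff W (i ∸ a) (j ∸ b)) ≈ 0#
      row-off zero    _ 0≢0 = contradiction Eq.refl 0≢0
      row-off (suc a) _ _   = sum-zero (suc j) (λ b _ → trans (*-congʳ (U-const (suc a) b (s≤s z≤n))) (zeroˡ _))
      column-off : ∀ b → b < suc j → b ≢ 0 → coeff U 0 b * coeff W i (j ∸ b) ≈ 0#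
      column-off zero    _ 0≢0 = contradiction Eq.refl 0≢0
      column-off (suc b) _ _   = trans (*-congʳ (U-const 0 (suc b) (s≤s z≤n))) (zeroˡ _)

  constant₂ : Carrier → Poly2
  constant₂ w = record { coeff = cf ; bound = 0 ; bounded = bd }
    where
      cf : Coeffs2
      cf zero zero = w
      cf _    _    = 0#
      bd : BoundedBy 0 cf
      bd zero    (suc j) _ = refl
      bd (suc i) j       _ = refl
      bd zero    zero    (inj₁ ())
      bd zero    zero    (inj₂ ())

  IsConstant⇒Unit2 : ∀ U → IsConstant U → Unit (coeff U 0 0) → Unit2 U
  IsConstant⇒Unit2 U U-const (w , u₀₀w≈1) = constant₂ w , one≈Uw
    where
      one≈Uw : IsProduct one₂ U (constant₂ w)
      one≈Uw zero    zero    = sym (trans (mulCoeff-constantˡ U (constant₂ w) U-const 0 0) u₀₀w≈1)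
      one≈Uw zero    (suc j) = sym (trans (mulCoeff-constantˡ U (constant₂ w) U-const 0 (suc j)) (zeroʳ _))
      one≈Uw (suc i) j       = sym (trans (mulCoeff-constantˡ U (constant₂ w) U-const (suc i) j) (zeroʳ _))

  -- restricted to y = 0, a unit of A[x,y] is a unit of A[x], hence of x-degree 0
  t₁₀≉0⇒¬Unit2 : ∀ T → coeff T 1 0 ≉ 0# → ¬ Unit2 T
  t₁₀≉0⇒¬Unit2 T t₁₀≉0 (W , one≈TW) = t₁₀≉0 (T₀-constant 1 (s≤s z≤n))
    where
      T₀ W₀ : Coeffs1
      T₀ i = coeff T i 0
      W₀ i = coeff W i 0
      T₀W₀≈1 : T₀ *₁ W₀ ≈₁ one₁
      T₀W₀≈1 i = trans (Sums.sum-cong A (suc i) (λ _ → sym (+-identityˡ _))) (trans (sym (one≈TW i 0)) (one₂₀ i))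
        where
          one₂₀ : ∀ i → coeff one₂ i 0 ≈ one₁ i
          one₂₀ zero    = refl
          one₂₀ (suc i) = refl
      W₀≉0 : ¬ (∀ i → W₀ i ≈ 0#)
      W₀≉0 W₀≈0 = proj₁ dom (trans (sym (T₀W₀≈1 0)) (trans (*₁-at0 T₀ W₀) (trans (*-congˡ (W₀≈0 0)) (zeroʳ _))))
      T₀-constant : Deg≤ 0 T₀
      T₀-constant = Deg≤-factor (bound T) (bound W) 0 T₀ W₀
                      (λ i lt → bounded T i 0 (inj₁ lt)) (λ i lt → bounded W i 0 (inj₁ lt))
                      (λ { (suc i) _ → T₀W₀≈1 (suc i) }) W₀≉0

  constant-factor≉0 : ∀ T U V → coeff T 1 0 ≉ 0# → IsProduct T U V → IsConstant U → coeff U 0 0 ≉ 0#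
  constant-factor≉0 T U V t₁₀≉0 T≈UV U-const u₀₀≈0 =
    t₁₀≉0 (trans (T≈UV 1 0) (trans (mulCoeff-constantˡ U V U-const 1 0) (trans (*-congʳ u₀₀≈0) (zeroˡ _))))

  irreducible-if-factors-constant : ∀ T → coeff T 1 0 ≉ 0# →
    (∀ U V → IsProduct T U V → IsConstant U ⊎ IsConstant V) →
    (∀ U V → IsProduct T U V → IsConstant U → Unit (coeff U 0 0)) → Irreducible2 T
  irreducible-if-factors-constant T t₁₀≉0 factor-constant constant-unit =
    (λ T≈0 → t₁₀≉0 (T≈0 1 0)) , t₁₀≉0⇒¬Unit2 T t₁₀≉0 , unit-factor
    where
      unit-factor : ∀ U V → IsProduct T U V → Unit2 U ⊎ Unit2 V
      unit-factor U V T≈UV with factor-constant U V T≈UV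
      ... | inj₁ U-const = inj₁ (IsConstant⇒Unit2 U U-const (constant-unit U V T≈UV U-const))
      ... | inj₂ V-const = inj₂ (IsConstant⇒Unit2 V V-const (constant-unit V U (IsProduct-comm T U V T≈UV) V-const))

  irreducible-over-field : (∀ x → x ≉ 0# → Unit x) → ∀ T → coeff T 1 0 ≉ 0# →
    (∀ U V → IsProduct T U V → IsConstant U ⊎ IsConstant V) → Irreducible2 T
  irreducible-over-field inverse T t₁₀≉0 factor-constant = irreducible-if-factors-constant T t₁₀≉0 factor-constant
    (λ U V T≈UV U-const → inverse (coeff U 0 0) (constant-factor≉0 T U V t₁₀≉0 T≈UV U-const))

  irreducible-if-content-one : ∀ T → coeff T 1 0 ≉ 0# →
    (∀ U V → IsProduct T U V → IsConstant U ⊎ IsConstant V) → ContentOne T → Irreducible2 T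
  irreducible-if-content-one T t₁₀≉0 factor-constant content-one =
    irreducible-if-factors-constant T t₁₀≉0 factor-constant
    (λ U V T≈UV U-const → content-one (coeff U 0 0)
      (λ i j → coeff V i j , trans (T≈UV i j) (mulCoeff-constantˡ U V U-const i j)))

module FractionFieldTransfer {a ℓa b ℓb : Level} (R : CommutativeRing a ℓa) (K : CommutativeRing b ℓb)
                             (F : FractionField R K) (domR : Over.IsIntegralDomain R) where
  private
    module R = CommutativeRing R
    module K = CommutativeRing K
    module OR = Over R
    module OK = Over K
    module CK = Convolution K
  open FractionField F
  open import Algebra.Morphism.Structures using (module RingMorphisms)
  open RingMorphisms R.rawRing K.rawRing
  open IsRingHomomorphism ι-hom

  ι-sumR : ∀ n f → ι (OR.sumR n f) K.≈ OK.sumR n (ι ∘ f)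
  ι-sumR zero    f = 0#-homo
  ι-sumR (suc n) f = K.trans (+-homo _ _) (K.+-congʳ (ι-sumR n f))

  ι-*₁ : ∀ f g k → ι ((f OR.*₁ g) k) K.≈ ((ι ∘ f) OK.*₁ (ι ∘ g)) k
  ι-*₁ f g k = K.trans (ι-sumR (suc k) _) (Sums.sum-cong K (suc k) (λ i → *-homo _ _))

  ι-ym1 : ∀ i → ι (OR.ym1 i) K.≈ OK.ym1 i
  ι-ym1 zero          = K.trans (-‿homo _) (K.-‿cong 1#-homo)
  ι-ym1 (suc zero)    = 1#-homo
  ι-ym1 (suc (suc i)) = 0#-homo

  ι-ym1^ : ∀ k i → ι ((OR.ym1 OR.^₁ k) i) K.≈ (OK.ym1 OK.^₁ k) i
  ι-ym1^ zero    zero    = 1#-homo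
  ι-ym1^ zero    (suc i) = 0#-homo
  ι-ym1^ (suc k) i       = K.trans (ι-*₁ OR.ym1 (OR.ym1 OR.^₁ k) i) (CK.*₁-cong ι-ym1 (ι-ym1^ k) i)

  ι-monoY : ∀ n i → ι (OR.monoY n i) K.≈ OK.monoY n i
  ι-monoY n i with i ℕ.≟ n
  ... | yes _ = 1#-homo
  ... | no  _ = 0#-homo

  ι≈0⇒≈0 : ∀ x → ι x K.≈ K.0# → x R.≈ R.0#
  ι≈0⇒≈0 x ιx≈0 = ι-inj x R.0# (K.trans ιx≈0 (K.sym 0#-homo))

  ι-brylawskiClear : ∀ t t' B m → (∀ i j → t' i j K.≈ ι (t i j)) →
                     ι (OR.brylawskiClear t B m) K.≈ OK.brylawskiClear t' B m
  ι-brylawskiClear t t' B m t'≈ιt =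
    K.trans (ι-sumR (suc B) _) (Sums.sum-cong K (suc B) (λ i → K.trans (ι-sumR (suc B) _) (Sums.sum-cong K (suc B) (λ j →
      K.trans (*-homo _ _) (K.*-cong (K.sym (t'≈ιt i j))
        (K.trans (ι-*₁ (OR.monoY (i ℕ.+ j)) (OR.ym1 OR.^₁ (B ∸ i)) m)
                 (CK.*₁-cong (ι-monoY (i ℕ.+ j)) (ι-ym1^ (B ∸ i)) m)))))))

  -- a fraction field is a domain because clearing denominators reduces x·y = 0 to R
  K-isIntegralDomain : OK.IsIntegralDomain
  K-isIntegralDomain = K-nontriv , K-noZeroDivisors
    where
      open Relation.Binary.Reasoning.Setoid K.setoid
      cancel-denominator : ∀ x p s → s R.≉ R.0# → x K.* ι s K.≈ ι p → p R.≈ R.0# → x K.≈ K.0#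
      cancel-denominator x p s s≉0 xs≈p p≈0 =
        let (s⁻¹ , ss⁻¹≈1) = K-inv (ι s) (s≉0 ∘ ι≈0⇒≈0 s) in begin
        x                   ≈⟨ K.sym (K.*-identityʳ x) ⟩
        x K.* K.1#          ≈⟨ K.*-congˡ (K.sym ss⁻¹≈1) ⟩
        x K.* (ι s K.* s⁻¹) ≈⟨ K.sym (K.*-assoc _ _ _) ⟩
        (x K.* ι s) K.* s⁻¹ ≈⟨ K.*-congʳ (K.trans xs≈p (K.trans (⟦⟧-cong p≈0) 0#-homo)) ⟩
        K.0# K.* s⁻¹        ≈⟨ K.zeroˡ _ ⟩
        K.0#                ∎
      K-noZeroDivisors : ∀ x y → x K.* y K.≈ K.0# → x K.≈ K.0# ⊎ y K.≈ K.0#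
      K-noZeroDivisors x y xy≈0 with K-frac x | K-frac y
      ... | (p , s , s≉0 , xs≈p) | (q , t , t≉0 , yt≈q) with proj₂ domR p q (ι≈0⇒≈0 _ ιpq≈0)
        where
          open import Algebra.Properties.CommutativeSemigroup K.*-commutativeSemigroup using (interchange)
          ιpq≈0 : ι (p R.* q) K.≈ K.0#
          ιpq≈0 = begin
            ι (p R.* q)                    ≈⟨ *-homo _ _ ⟩
            ι p K.* ι q                    ≈⟨ K.sym (K.*-cong xs≈p yt≈q) ⟩
            (x K.* ι s) K.* (y K.* ι t)    ≈⟨ interchange _ _ _ _ ⟩
            (x K.* y) K.* (ι s K.* ι t)    ≈⟨ K.*-congʳ xy≈0 ⟩
            K.0# K.* (ι s K.* ι t)         ≈⟨ K.zeroˡ _ ⟩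
            K.0#                           ∎
      ... | inj₁ p≈0 = inj₁ (cancel-denominator x p s s≉0 xs≈p p≈0)
      ... | inj₂ q≈0 = inj₂ (cancel-denominator y q t t≉0 yt≈q q≈0)

  private
    module BR = Brylawski R domR
    module BK = Brylawski K K-isIntegralDomain

  IsBrylawskiAt-ι : ∀ n r c T T' B → (∀ i j → Over.coeff T' i j K.≈ ι (Over.coeff T i j)) →
                    BR.IsBrylawskiAt n r c T B → BK.IsBrylawskiAt n r (ι c) T' B
  IsBrylawskiAt-ι n r c T T' B T'≈ιT brylawski m = begin
    ((OK.ym1 OK.^₁ r) OK.*₁ OK.brylawskiClear (OK.coeff T') B) m
      ≈⟨ CK.*₁-cong (K.sym ∘ ι-ym1^ r) (λ i → K.sym (ι-brylawskiClear (OR.coeff T) (OK.coeff T') B i T'≈ιT)) m ⟩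
    ((ι ∘ (OR.ym1 OR.^₁ r)) OK.*₁ (ι ∘ OR.brylawskiClear (OR.coeff T) B)) m
      ≈⟨ K.sym (ι-*₁ (OR.ym1 OR.^₁ r) (OR.brylawskiClear (OR.coeff T) B) m) ⟩
    ι (((OR.ym1 OR.^₁ r) OR.*₁ OR.brylawskiClear (OR.coeff T) B) m)
      ≈⟨ ⟦⟧-cong (brylawski m) ⟩
    ι (c R.* (OR.monoY n OR.*₁ (OR.ym1 OR.^₁ B)) m)
      ≈⟨ *-homo _ _ ⟩
    ι c K.* ι ((OR.monoY n OR.*₁ (OR.ym1 OR.^₁ B)) m)
      ≈⟨ K.*-congˡ (K.trans (ι-*₁ (OR.monoY n) (OR.ym1 OR.^₁ B) m) (CK.*₁-cong (ι-monoY n) (ι-ym1^ B) m)) ⟩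
    ι c K.* (OK.monoY n OK.*₁ (OK.ym1 OK.^₁ B)) m ∎
    where open Relation.Binary.Reasoning.Setoid K.setoid

  ι-reflects-sum≈0 : ∀ N f g → (∀ i → g i K.≈ ι (f i)) → OK.sumR N g K.≈ K.0# → OR.sumR N f R.≈ R.0#
  ι-reflects-sum≈0 N f g g≈ιf g≈0 = ι≈0⇒≈0 _ (K.trans (ι-sumR N f) (K.trans (Sums.sum-cong K N (K.sym ∘ g≈ιf)) g≈0))

  BrylawskiHypotheses-ι : ∀ T T' → (∀ i j → Over.coeff T' i j K.≈ ι (Over.coeff T i j)) →
                          BR.BrylawskiHypotheses T → BK.BrylawskiHypotheses T'
  BrylawskiHypotheses-ι T T' T'≈ιT hyp = record
    { n = n ; r = r ; B = B ; dx = dx ; dy = dy ; c = ι c ; 1≤n = 1≤n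
    ; c≉0         = c≉0 ∘ ι≈0⇒≈0 c
    ; boundX      = λ i B<i j → ≈0 (boundX i B<i j)
    ; boundY      = λ i j B<j → ≈0 (boundY i j B<j)
    ; brylawski   = IsBrylawskiAt-ι n r c T T' B T'≈ιT brylawski
    ; T≢0atX1     = λ T'≈0 → T≢0atX1 (λ j → ι-reflects-sum≈0 (suc B) _ _ (λ i → T'≈ιT i j) (T'≈0 j))
    ; T≢0atY1     = λ T'≈0 → T≢0atY1 (λ i → ι-reflects-sum≈0 (suc B) _ _ (T'≈ιT i) (T'≈0 i))
    ; t₁₀≉0       = t₁₀≉0 ∘ ι≈0⇒≈0 _ ∘ K.trans (K.sym (T'≈ιT 1 0))
    ; degX        = λ i dx<i j → ≈0 (degX i dx<i j)
    ; degY        = λ i j dy<j → ≈0 (degY i j dy<j)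
    ; dx+dy≤1+n   = dx+dy≤1+n }
    where
      open BR.BrylawskiHypotheses hyp
      ≈0 : ∀ {i j} → OR.coeff T i j R.≈ R.0# → OK.coeff T' i j K.≈ K.0#
      ≈0 {i} {j} Tij≈0 = K.trans (T'≈ιT i j) (K.trans (⟦⟧-cong Tij≈0) 0#-homo)

open import Data.Nat using (_+_)

theorem2p10 :
    ∀ {c ℓ c' ℓ' : Level} (R : CommutativeRing c ℓ) → Over.IsUFD R →
    ∀ (n r : ℕ) (cst : CommutativeRing.Carrier R) (T : Over.Poly2 R) →
    1 ≤ r → r < n →
    Over.IsBrylawski R n r cst T →
    ¬ Over.Divides2 R (Over.xm1 R) T →
    ¬ Over.Divides2 R (Over.ym1₂ R) T →
    CommutativeRing._≉_ R (Over.coeff T 1 0) (CommutativeRing.0# R) →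
    (Σ ℕ λ dx → Σ ℕ λ dy → Over.DegX R T dx × Over.DegY R T dy ×
       (dx + dy ≡ n ⊎ dx + dy ≡ suc n)) →
    (∀ (U V : Over.Poly2 R) → Over.IsProduct R T U V →
       Over.IsConstant R U ⊎ Over.IsConstant R V)
    ×
    (∀ (K : CommutativeRing c' ℓ') (F : FractionField R K) (T' : Over.Poly2 K) →
       (∀ i j → CommutativeRing._≈_ K (Over.coeff T' i j)
                  (FractionField.ι F (Over.coeff T i j))) →
       Over.Irreducible2 K T')
    ×
    (Over.ContentOne R T → Over.Irreducible2 R T)
-- only n ≥ 1 (from r < n) and that R is a domain are used
theorem2p10 {c' = c'} {ℓ' = ℓ'} R ufd n r c T _ r<n isBrylawski ¬xm1∣T ¬ym1₂∣T t₁₀≉0 degrees =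
  factor-constant , irreducible-over-K , Irreducibility.irreducible-if-content-one R dom T t₁₀≉0 factor-constant
  where
    open Over R using (IsProduct; IsConstant)
    dom : Over.IsIntegralDomain R
    dom = proj₁ ufd
    hyp : Brylawski.BrylawskiHypotheses R dom T
    hyp = Brylawski.BrylawskiHypotheses-intro R dom n r c T r<n isBrylawski ¬xm1∣T ¬ym1₂∣T t₁₀≉0 degrees
    factor-constant : ∀ U V → IsProduct T U V → IsConstant U ⊎ IsConstant V
    factor-constant = Brylawski.BrylawskiFactors.factor-constant R dom hyp
    irreducible-over-K : ∀ (K : CommutativeRing c' ℓ') (F : FractionField R K) (T' : Over.Poly2 K) →
                         (∀ i j → CommutativeRing._≈_ K (Over.coeff T' i j) (FractionField.ι F (Over.coeff T i j))) →
                         Over.Irreducible2 K T'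
    irreducible-over-K K F T' T'≈ιT =
      Irreducibility.irreducible-over-field K K-isIntegralDomain (FractionField.K-inv F) T'
        (BrylawskiHypotheses.t₁₀≉0 hypK) (BrylawskiFactors.factor-constant hypK)
      where
        open FractionFieldTransfer R K F dom
        open Brylawski K K-isIntegralDomain
        hypK : BrylawskiHypotheses T'
        hypK = BrylawskiHypotheses-ι T T' T'≈ιT hyp
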